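{- Let $d\ge1$, $k\ge0$, $n=d+k+1$, and let $\gamma=(\gamma_1,\dots,\gamma_l)$, $l\ge1$, be the type of some element of $L_{n,d}$. Enumerate the subsets of $\{1,\dots,l\}$ as $I_1,\dots,I_{2^l}$. Then \[ \lambda_{n,d}(\gamma)=\frac{1}{\prod_{s\ge1}m_s(\gamma)!}\sum_{\nu\in N(n,d;\gamma)}\binom{n}{\nu(I_1),\nu(I_2),\dots,\nu(I_{2^l})}, \] where $m_s(\gamma)=|\{i:\gamma_i=s\}|$ and the binomial symbol denotes the multinomial coefficient.
   Context: For integers $n\ge 1$, $d\ge 0$: for a finite set $X$ put $\operatorname{codim}_d(X)=d+1-|X|$. For a family $T=\{T_1,\dots,T_l\}$ of distinct finite sets put $\rho_d(T)=\sum_i\operatorname{codim}_d(T_i)$ and $D_d(T)=\operatorname{codim}_d(T_1\cap\dots\cap T_l)-\rho_d(T)$. Let $L_{n,d}$ be the set of families $T\subset 2^{\{1,\dots,n\}}$ such that $0\le|T_i|\le d$ for all $T_i\in T$ and $D_d(T')>0$ for every subfamily $T'\subset T$ with $|T'|>1$. The type of $T=\{T_1,\dots,T_l\}\in L_{n,d}$, listed so that $|T_1|\le\dots\le|T_l|$, is the partition $(\operatorname{codim}_d(T_1),\dots,\operatorname{codim}_d(T_l))$. $\lambda_{n,d}(\gamma)$ is the number of elements of $L_{n,d}$ of type $\gamma$. Let $\tilde L_{n,d}(\gamma)$ be the set of ordered tuples $(T_1,\dots,T_l)$ of pairwise distinct subsets of $\{1,\dots,n\}$ such that $\{T_1,\dots,T_l\}\in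 L_{n,d}$ and $\operatorname{codim}_d(T_i)=\gamma_i$ for each $i$. For such a tuple $T$ define $\nu_T:2^{\{1,\dots,l\}}\to\mathbb N$ by $\nu_T(I)=\bigl|\bigcap_{i\in I}T_i\setminus\bigcup_{i\notin I}T_i\bigr|$, where the empty intersection means $\{1,\dots,n\}$ (so $\nu_T(I)$ counts the elements of $\{1,\dots,n\}$ lying in $T_i$ exactly for $i\in I$). $N(n,d;\gamma)=\{\nu_T: T\in\tilde L_{n,d}(\gamma)\}$. -}

module Defs where

open import Data.Bool using (Bool; true; false; _∧_; not; if_then_else_)
open import Data.Nat using (ℕ; zero; suc; _+_; _*_; _∸_; _≤ᵇ_; _≡ᵇ_; _!)
open import Data.Nat.Combinatorics using (_C_)
open import Data.Integer as ℤ using (ℤ; +_; +0)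
open import Data.List using (List; []; _∷_; _++_; map; concatMap; filter; length; foldr; deduplicate; upTo; allFin)
open import Data.Nat.ListAction using (sum; product)
open import Data.Bool.ListAction using (all; any)
open import Data.List.Properties as LP using ()
open import Data.Vec as Vec using (Vec; []; _∷_; toList; lookup; tabulate)
open import Data.Vec.Properties as VP using ()
open import Data.Fin using (Fin)
open import Data.Fin.Subset using (Subset; inside; outside; ⊤; _∩_; ∣_∣)
open import Relation.Nullary using (does)
open import Relation.Nullary.Decidable using (⌊_⌋)
import Data.Bool as B
import Data.Nat as N

count : {A : Set} → (A → Bool) → List A → ℕ
count p xs = length (filter (λ x → B.T? (p x)) xs)

_≟ˢ_ : ∀ {n} → (S T : Subset n) → Bool
S ≟ˢ T = does (VP.≡-dec B._≟_ S T)

_≟ᴸ_ : (xs ys : List ℕ) → Bool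
xs ≟ᴸ ys = does (LP.≡-dec N._≟_ xs ys)

allSubsets : (n : ℕ) → List (Subset n)
allSubsets zero    = [] ∷ []
allSubsets (suc n) = map (outside ∷_) (allSubsets n) ++ map (inside ∷_) (allSubsets n)

sublists : {A : Set} → List A → List (List A)
sublists []       = [] ∷ []
sublists (x ∷ xs) = sublists xs ++ map (x ∷_) (sublists xs)

-- all families of subsets of {1..n}: each family (a set of subsets)
-- appears exactly once, as a sublist of allSubsets n
allFamilies : (n : ℕ) → List (List (Subset n))
allFamilies n = sublists (allSubsets n)

codim : ∀ {n} → ℕ → Subset n → ℤ
codim d X = + (suc d) ℤ.- + ∣ X ∣

rho : ∀ {n} → ℕ → List (Subset n) → ℤ
rho d T = foldr (λ X r → codim d X ℤ.+ r) +0 T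

-- intersection of a family (empty intersection = {1..n})
⋂ : ∀ {n} → List (Subset n) → Subset n
⋂ T = foldr _∩_ ⊤ T

D : ∀ {n} → ℕ → List (Subset n) → ℤ
D d T = codim d (⋂ T) ℤ.- rho d T

isL : ∀ {n} → ℕ → List (Subset n) → Bool
isL d T = all (λ X → ∣ X ∣ ≤ᵇ d) T
        ∧ all (λ T' → (length T' ≤ᵇ 1) B.∨ ⌊ +0 ℤ.<? D d T' ⌋) (sublists T)

Lfam : (n d : ℕ) → List (List (Subset n))
Lfam n d = filter (λ T → B.T? (isL d T)) (allFamilies n)

-- codimension as a natural number (used for types; equals codim_d when |X| ≤ d)
codimℕ : ∀ {n} → ℕ → Subset n → ℕ
codimℕ d X = suc d ∸ ∣ X ∣

insertDesc : ℕ → List ℕ → List ℕ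
insertDesc x []       = x ∷ []
insertDesc x (y ∷ ys) = if y ≤ᵇ x then x ∷ y ∷ ys else y ∷ insertDesc x ys

sortDesc : List ℕ → List ℕ
sortDesc = foldr insertDesc []

-- the type of T: codims listed with |T_1| ≤ ... ≤ |T_l|, i.e. codims non-increasing
typeOf : ∀ {n} → ℕ → List (Subset n) → List ℕ
typeOf d T = sortDesc (map (codimℕ d) T)

lambda : (n d : ℕ) → List ℕ → ℕ
lambda n d γ = length (filter (λ T → B.T? (typeOf d T ≟ᴸ γ)) (Lfam n d))

allTuples : (n l : ℕ) → List (Vec (Subset n) l)
allTuples n zero    = [] ∷ []
allTuples n (suc l) = concatMap (λ S → map (S ∷_) (allTuples n l)) (allSubsets n)

pairwiseDistinct : ∀ {n} → List (Subset n) → Bool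
pairwiseDistinct []       = true
pairwiseDistinct (X ∷ Xs) = not (any (X ≟ˢ_) Xs) ∧ pairwiseDistinct Xs

Ltilde : (n d : ℕ) (γ : List ℕ) → List (Vec (Subset n) (length γ))
Ltilde n d γ = filter (λ T → B.T? (pairwiseDistinct (toList T) ∧ isL d (toList T)
                                    ∧ (map (codimℕ d) (toList T) ≟ᴸ γ)))
                      (allTuples n (length γ))

nu : ∀ {n l} → Vec (Subset n) l → Subset l → ℕ
nu {n} T I = count (λ x → (tabulate (λ i → lookup (lookup T i) x) ≟ˢ I)) (allFin n)

-- nu_T as the list of values (nu_T(I_1), ..., nu_T(I_{2^l})) for the fixed
-- enumeration I_1, ..., I_{2^l} = allSubsets l
nuList : ∀ {n l} → Vec (Subset n) l → List ℕ
nuList {l = l} T = map (nu T) (allSubsets l)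

Nset : (n d : ℕ) → List ℕ → List (List ℕ)
Nset n d γ = deduplicate (LP.≡-dec N._≟_) (map nuList (Ltilde n d γ))

-- multinomial coefficient (n ; k_1, ..., k_m) = C(n,k_1) C(n-k_1,k_2) ...
-- (= n! / (k_1! ... k_m!) when k_1 + ... + k_m = n, and 0 otherwise)
multinomial : ℕ → List ℕ → ℕ
multinomial zero    []       = 1
multinomial (suc _) []       = 0
multinomial n       (k ∷ ks) = (n C k) * multinomial (n ∸ k) ks

mult : ℕ → List ℕ → ℕ
mult s γ = count (λ x → x ≡ᵇ s) γ

-- ∏_{s ≥ 1} m_s(γ)!  (factors with s > sum γ are 0! = 1, so the range 1..sum γ suffices)
multFactProd : List ℕ → ℕ
multFactProd γ = product (map (λ s → (mult (suc s) γ) !) (upTo (sum γ)))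

module Submission where

-- Both sides count L̃(γ), the tuples (T₁,…,Tₗ) of distinct sets whose family lies in L_{n,d}
-- and whose codimensions are γ₁,…,γₗ in this order.
-- A family of type γ admits exactly ∏ₛ mₛ(γ)! such orderings, as only sets of equal
-- codimension can be exchanged; hence |L̃(γ)| = λ_{n,d}(γ) ∏ₛ mₛ(γ)!.
-- On the other hand, every ingredient of the definition of L_{n,d} (the sizes of the Tᵢ and of
-- their intersections, and whether Tᵢ = Tⱼ) is a sum of ν_T over the Venn regions, so membership
-- in L̃(γ) depends on T only through ν_T; and the tuples with a prescribed ν are obtained by
-- distributing the n points among the 2ˡ regions, in multinomially many ways.

open import Defs

open import Algebra.Bundles using (CommutativeMonoid)
import Algebra.Properties.CommutativeSemigroup as CommutativeSemigroupProperties
open import Data.Bool using (Bool; true; false; _∧_; _∨_; not; _xor_; if_then_else_; T)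
import Data.Bool as Bool
open import Data.Bool.Properties using (∧-assoc; ∧-isCommutativeMonoid; ∧-commutativeMonoid; ∨-isCommutativeMonoid)
import Data.Bool.Properties as Bool
open import Data.Bool.ListAction using (and; or; all; any)
open import Data.Fin using (Fin; zero; suc)
open import Data.Fin.Subset using (Subset; ∣_∣; inside)
open import Data.Fin.Subset.Properties using (∩-isCommutativeMonoid)
open import Data.Integer as ℤ using (+0)
import Data.Integer.Properties as ℤ
open import Data.List as List using (List; []; _∷_; _++_; map; concatMap; filter; length; foldr; deduplicate; applyUpTo)
import Data.List.Properties as List
open import Data.List.Membership.Propositional using (_∈_; find)
open import Data.List.Membership.Propositional.Properties using (∈-deduplicate⁻; ∈-map⁻; ∈-filter⁻)
open import Data.List.Relation.Binary.Disjoint.Propositional using (Disjoint)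
open import Data.List.Relation.Binary.Permutation.Propositional as ↭ using (_↭_; prep; swap; ↭⇒↭ₛ)
import Data.List.Relation.Binary.Permutation.Propositional.Properties as ↭
open import Data.List.Relation.Binary.Permutation.Setoid.Properties using (foldr-commMonoid)
open import Data.List.Relation.Unary.All as All using (All; []; _∷_)
import Data.List.Relation.Unary.All.Properties as All
import Data.List.Relation.Unary.AllPairs as AllPairs
open import Data.List.Relation.Unary.Any using (Any; here; there)
open import Data.List.Relation.Unary.Unique.Propositional using (Unique)
import Data.List.Relation.Unary.Unique.Propositional.Properties as Unique
open import Data.Nat as ℕ using (ℕ; zero; suc; _+_; _*_; _∸_; _≡ᵇ_; _≤ᵇ_; _<ᵇ_; _≤_; _<_; s≤s; z≤n; _≤?_; _!)
open import Data.Nat.Combinatorics using (_C_; k>n⇒nCk≡0; nCk+nC[k+1]≡[n+1]C[k+1])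
open import Data.Nat.ListAction using (sum; product)
open import Data.Nat.ListAction.Properties using (sum-++)
open import Data.Nat.Properties
open import Data.Nat.Tactic.RingSolver using (solve-∀)
open import Data.Product using (_×_; _,_; proj₁; proj₂)
open import Data.Sum using (_⊎_; inj₁; inj₂)
open import Data.Unit using (⊤; tt)
open import Data.Vec as Vec using (Vec; []; _∷_; lookup; tabulate; zipWith; toList)
import Data.Vec.Properties as Vec
open import Function using (_∘_; Equivalence)
open import Relation.Binary.Definitions using (DecidableEquality)
open import Relation.Binary.PropositionalEquality
open import Relation.Nullary using (Reflects; ofʸ; ofⁿ; proof; contradiction; yes; no; does; ¬?)
open import Relation.Nullary.Decidable using (dec-true; dec-false; ⌊_⌋)
open import Relation.Unary using (Pred; Decidable)

open CommutativeSemigroupProperties +-commutativeSemigroup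
  using () renaming (interchange to +-interchange; x∙yz≈y∙xz to +-left-comm)
open CommutativeSemigroupProperties *-commutativeSemigroup
  using () renaming (x∙yz≈y∙xz to *-left-comm)
open CommutativeSemigroupProperties (CommutativeMonoid.commutativeSemigroup ∧-commutativeMonoid)
  using () renaming (interchange to ∧-interchange)

private variable A B : Set

𝟙 : Bool → ℕ
𝟙 true  = 1
𝟙 false = 0

𝟙-∧ : ∀ a b → 𝟙 (a ∧ b) ≡ 𝟙 a * 𝟙 b
𝟙-∧ true  b = sym (+-identityʳ (𝟙 b))
𝟙-∧ false b = refl

∑ : List A → (A → ℕ) → ℕ
∑ xs f = sum (map f xs)


∑-++ : ∀ (xs ys : List A) f → ∑ (xs ++ ys) f ≡ ∑ xs f + ∑ ys f
∑-++ xs ys f = trans (cong sum (List.map-++ f xs ys)) (sum-++ (map f xs) (map f ys))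

∑-map : ∀ (g : A → B) xs f → ∑ (map g xs) f ≡ ∑ xs (λ x → f (g x))
∑-map g xs f = cong sum (sym (List.map-∘ xs))

∑-cong : ∀ (xs : List A) {f g} → (∀ x → f x ≡ g x) → ∑ xs f ≡ ∑ xs g
∑-cong xs f≗g = cong sum (List.map-cong f≗g xs)

∑-cong-∈ : ∀ (xs : List A) {f g} → (∀ x → x ∈ xs → f x ≡ g x) → ∑ xs f ≡ ∑ xs g
∑-cong-∈ []       _   = refl
∑-cong-∈ (x ∷ xs) f≗g = cong₂ _+_ (f≗g x (here refl)) (∑-cong-∈ xs (λ y y∈ → f≗g y (there y∈)))

∑-zero : ∀ (xs : List A) → ∑ xs (λ _ → 0) ≡ 0
∑-zero []       = refl
∑-zero (x ∷ xs) = ∑-zero xs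

∑-+ : ∀ (xs : List A) f g → ∑ xs (λ x → f x + g x) ≡ ∑ xs f + ∑ xs g
∑-+ []       f g = refl
∑-+ (x ∷ xs) f g = trans (cong (f x + g x +_) (∑-+ xs f g)) (+-interchange (f x) (g x) (∑ xs f) (∑ xs g))

∑-*ˡ : ∀ (xs : List A) c f → ∑ xs (λ x → c * f x) ≡ c * ∑ xs f
∑-*ˡ []       c f = sym (*-zeroʳ c)
∑-*ˡ (x ∷ xs) c f = trans (cong (c * f x +_) (∑-*ˡ xs c f)) (sym (*-distribˡ-+ c (f x) (∑ xs f)))

∑-swap : ∀ (xs : List A) (ys : List B) (f : A → B → ℕ) →
  ∑ xs (λ x → ∑ ys (f x)) ≡ ∑ ys (λ y → ∑ xs (λ x → f x y))
∑-swap []       ys f = sym (∑-zero ys)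
∑-swap (x ∷ xs) ys f = trans (cong (∑ ys (f x) +_) (∑-swap xs ys f)) (sym (∑-+ ys (f x) (λ y → ∑ xs (λ x → f x y))))

∑-concatMap : ∀ (g : A → List B) xs f → ∑ (concatMap g xs) f ≡ ∑ xs (λ x → ∑ (g x) f)
∑-concatMap g []       f = refl
∑-concatMap g (x ∷ xs) f = trans (∑-++ (g x) (concatMap g xs) f) (cong (∑ (g x) f +_) (∑-concatMap g xs f))

∑-filter : ∀ {ℓ} {P : Pred A ℓ} (P? : Decidable P) xs f →
  ∑ (filter P? xs) f ≡ ∑ xs (λ x → 𝟙 (does (P? x)) * f x)
∑-filter P? []       f = refl
∑-filter P? (x ∷ xs) f with does (P? x)
... | true  = cong₂ _+_ (sym (+-identityʳ (f x))) (∑-filter P? xs f)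
... | false = ∑-filter P? xs f

length≡∑ : ∀ (xs : List A) → length xs ≡ ∑ xs (λ _ → 1)
length≡∑ []       = refl
length≡∑ (x ∷ xs) = cong suc (length≡∑ xs)

module _ (_≟_ : DecidableEquality A) where

  multiplicity : A → List A → ℕ
  multiplicity v ys = ∑ ys (λ y → 𝟙 (does (v ≟ y)))

  private
    dedup = deduplicate _≟_

    _≠_ : A → A → Bool
    y ≠ v = not (does (y ≟ v))

    𝟙-split : ∀ b x → x ≡ 𝟙 b * x + 𝟙 (not b) * x
    𝟙-split true  x = sym (trans (cong (_+ 0) (+-identityʳ x)) (+-identityʳ x))
    𝟙-split false x = sym (+-identityʳ x)

    𝟙-not-annihilates : ∀ b x → 𝟙 (not b) * (𝟙 b * x) ≡ 0
    𝟙-not-annihilates true  x = refl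
    𝟙-not-annihilates false x = refl

    ∑-filter-≠ : ∀ y zs h → ∑ (filter (¬? ∘ (y ≟_)) zs) h ≡ ∑ zs (λ v → 𝟙 (y ≠ v) * h v)
    ∑-filter-≠ y zs h = ∑-filter (λ v → ¬? (y ≟ v)) zs h

    multiplicity-≠ : ∀ {y v} ys → v ≢ y → multiplicity v (y ∷ ys) ≡ multiplicity v ys
    multiplicity-≠ {y} {v} ys v≢y = cong (λ b → 𝟙 b + multiplicity v ys) (dec-false (v ≟ y) v≢y)

    ∑-dedup-at : ∀ y zs → ∑ (dedup zs) (λ v → 𝟙 (does (y ≟ v)) * multiplicity v zs) ≡ multiplicity y zs
    ∑-dedup-at y []       = refl
    ∑-dedup-at y (z ∷ zs) with y ≟ z
    ... | yes refl = trans (cong₂ _+_ occurrence-of-y others-vanish) (+-identityʳ _)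
      where
      occurrence-of-y : 1 * (𝟙 (does (y ≟ y)) + multiplicity y zs) ≡ suc (multiplicity y zs)
      occurrence-of-y = trans (*-identityˡ _) (cong (λ b → 𝟙 b + multiplicity y zs) (dec-true (y ≟ y) refl))
      others-vanish : ∑ (filter (¬? ∘ (y ≟_)) (dedup zs)) (λ v → 𝟙 (does (y ≟ v)) * multiplicity v (y ∷ zs)) ≡ 0
      others-vanish = trans (∑-filter-≠ y (dedup zs) _)
        (trans (∑-cong (dedup zs) (λ v → 𝟙-not-annihilates (does (y ≟ v)) _)) (∑-zero (dedup zs)))
    ... | no y≢z = trans (∑-filter-≠ z (dedup zs) _) (trans (∑-cong (dedup zs) only-y) (∑-dedup-at y zs))
      where
      only-y : ∀ v → 𝟙 (z ≠ v) * (𝟙 (does (y ≟ v)) * multiplicity v (z ∷ zs)) ≡ 𝟙 (does (y ≟ v)) * multiplicity v zs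
      only-y v with y ≟ v
      ... | yes refl = begin
        𝟙 (z ≠ y) * (1 * multiplicity y (z ∷ zs))
          ≡⟨ cong (λ b → 𝟙 (not b) * (1 * multiplicity y (z ∷ zs))) (dec-false (z ≟ y) (y≢z ∘ sym)) ⟩
        1 * (1 * multiplicity y (z ∷ zs))
          ≡⟨ *-identityˡ _ ⟩
        1 * multiplicity y (z ∷ zs)
          ≡⟨ cong (1 *_) (multiplicity-≠ zs y≢z) ⟩
        1 * multiplicity y zs ∎
        where open ≡-Reasoning
      ... | no _     = *-zeroʳ (𝟙 (z ≠ v))

  length≡∑-multiplicity : ∀ ys → length ys ≡ ∑ (dedup ys) (λ v → multiplicity v ys)
  length≡∑-multiplicity []       = refl
  length≡∑-multiplicity (y ∷ ys) = begin
    suc (length ys)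
      ≡⟨ cong suc (length≡∑-multiplicity ys) ⟩
    suc (∑ (dedup ys) (λ v → multiplicity v ys))
      ≡⟨ cong suc (trans (∑-cong (dedup ys) (λ v → 𝟙-split (does (y ≟ v)) (multiplicity v ys))) (∑-+ (dedup ys) _ _)) ⟩
    suc (∑ (dedup ys) (λ v → 𝟙 (does (y ≟ v)) * multiplicity v ys) + ∑ (dedup ys) (λ v → 𝟙 (y ≠ v) * multiplicity v ys))
      ≡⟨ cong (λ m → suc (m + ∑ (dedup ys) (λ v → 𝟙 (y ≠ v) * multiplicity v ys))) (∑-dedup-at y ys) ⟩
    suc (multiplicity y ys) + ∑ (dedup ys) (λ v → 𝟙 (y ≠ v) * multiplicity v ys)
      ≡⟨ cong₂ _+_ (cong (λ b → 𝟙 b + multiplicity y ys) (sym (dec-true (y ≟ y) refl)))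
                   (sym (trans (∑-filter-≠ y (dedup ys) _) (∑-cong (dedup ys) away-from-y))) ⟩
    multiplicity y (y ∷ ys) + ∑ (filter (¬? ∘ (y ≟_)) (dedup ys)) (λ v → multiplicity v (y ∷ ys)) ∎
    where
    open ≡-Reasoning
    away-from-y : ∀ v → 𝟙 (y ≠ v) * multiplicity v (y ∷ ys) ≡ 𝟙 (y ≠ v) * multiplicity v ys
    away-from-y v with y ≟ v
    ... | yes refl = refl
    ... | no y≢v   = cong (1 *_) (multiplicity-≠ ys (y≢v ∘ sym))

-- Multinomial coefficients and tuples with prescribed Venn counts

-- ∑⁺ Φ w sums Φ over the vectors w + eⱼ; ∑⁻ Ψ v sums Ψ over the vectors v − eⱼ with vⱼ > 0.
∑⁺ : (List ℕ → ℕ) → List ℕ → ℕ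
∑⁺ Φ []      = 0
∑⁺ Φ (x ∷ w) = Φ (suc x ∷ w) + ∑⁺ (λ u → Φ (x ∷ u)) w

∑⁻ : (List ℕ → ℕ) → List ℕ → ℕ
∑⁻ Ψ []          = 0
∑⁻ Ψ (zero ∷ v)  = ∑⁻ (λ u → Ψ (zero ∷ u)) v
∑⁻ Ψ (suc k ∷ v) = Ψ (k ∷ v) + ∑⁻ (λ u → Ψ (suc k ∷ u)) v

∑⁺-zero : ∀ w → ∑⁺ (λ _ → 0) w ≡ 0
∑⁺-zero []      = refl
∑⁺-zero (x ∷ w) = ∑⁺-zero w

∑⁺-++ : ∀ Φ xs ys → ∑⁺ Φ (xs ++ ys) ≡ ∑⁺ (λ w → Φ (w ++ ys)) xs + ∑⁺ (λ w → Φ (xs ++ w)) ys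
∑⁺-++ Φ []       ys = refl
∑⁺-++ Φ (x ∷ xs) ys =
  trans (cong (Φ (suc x ∷ xs ++ ys) +_) (∑⁺-++ (λ u → Φ (x ∷ u)) xs ys)) (sym (+-assoc (Φ (suc x ∷ xs ++ ys)) _ _))

∑⁻-cong : ∀ {Ψ Ψ′} v → (∀ t → length t ≡ length v → Ψ t ≡ Ψ′ t) → ∑⁻ Ψ v ≡ ∑⁻ Ψ′ v
∑⁻-cong []          _  = refl
∑⁻-cong (zero ∷ v)  eq = ∑⁻-cong v (λ t ∣t∣ → eq (zero ∷ t) (cong suc ∣t∣))
∑⁻-cong (suc k ∷ v) eq = cong₂ _+_ (eq (k ∷ v) refl) (∑⁻-cong v (λ t ∣t∣ → eq (suc k ∷ t) (cong suc ∣t∣)))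

∑⁻-*ˡ : ∀ c Ψ v → ∑⁻ (λ u → c * Ψ u) v ≡ c * ∑⁻ Ψ v
∑⁻-*ˡ c Ψ []          = sym (*-zeroʳ c)
∑⁻-*ˡ c Ψ (zero ∷ v)  = ∑⁻-*ˡ c (λ u → Ψ (zero ∷ u)) v
∑⁻-*ˡ c Ψ (suc k ∷ v) =
  trans (cong (c * Ψ (k ∷ v) +_) (∑⁻-*ˡ c (λ u → Ψ (suc k ∷ u)) v)) (sym (*-distribˡ-+ c _ _))

∑⁻-zero : ∀ v → ∑⁻ (λ _ → 0) v ≡ 0
∑⁻-zero []          = refl
∑⁻-zero (zero ∷ v)  = ∑⁻-zero v
∑⁻-zero (suc k ∷ v) = ∑⁻-zero v

∑-∑⁻ : ∀ (xs : List A) (Ψ : A → List ℕ → ℕ) v →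
  ∑ xs (λ x → ∑⁻ (Ψ x) v) ≡ ∑⁻ (λ t → ∑ xs (λ x → Ψ x t)) v
∑-∑⁻ xs Ψ []          = ∑-zero xs
∑-∑⁻ xs Ψ (zero ∷ v)  = ∑-∑⁻ xs (λ x u → Ψ x (zero ∷ u)) v
∑-∑⁻ xs Ψ (suc k ∷ v) =
  trans (∑-+ xs _ _) (cong (∑ xs (λ x → Ψ x (k ∷ v)) +_) (∑-∑⁻ xs (λ x u → Ψ x (suc k ∷ u)) v))

∑⁺-∑⁻-guard : ∀ b u v → ∑⁺ (λ w → 𝟙 (w ≟ᴸ v)) u ≡ ∑⁻ (λ t → 𝟙 (u ≟ᴸ t)) v →
  ∑⁺ (λ w → 𝟙 (b ∧ (w ≟ᴸ v))) u ≡ ∑⁻ (λ t → 𝟙 (b ∧ (u ≟ᴸ t))) v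
∑⁺-∑⁻-guard true  u v eq = eq
∑⁺-∑⁻-guard false u v _  = trans (∑⁺-zero u) (sym (∑⁻-zero v))

-- u + eⱼ = v  iff  u = v − eⱼ
∑⁺-hit≡∑⁻-hit : ∀ u v → ∑⁺ (λ w → 𝟙 (w ≟ᴸ v)) u ≡ ∑⁻ (λ t → 𝟙 (u ≟ᴸ t)) v
∑⁺-hit≡∑⁻-hit []      []          = refl
∑⁺-hit≡∑⁻-hit []      (zero ∷ v)  = sym (∑⁻-zero v)
∑⁺-hit≡∑⁻-hit []      (suc k ∷ v) = sym (∑⁻-zero v)
∑⁺-hit≡∑⁻-hit (x ∷ u) []          = ∑⁺-zero u
∑⁺-hit≡∑⁻-hit (x ∷ u) (zero ∷ v)  = ∑⁺-∑⁻-guard (x ≡ᵇ zero) u v (∑⁺-hit≡∑⁻-hit u v)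
∑⁺-hit≡∑⁻-hit (x ∷ u) (suc k ∷ v) =
  cong (𝟙 ((x ≡ᵇ k) ∧ (u ≟ᴸ v)) +_) (∑⁺-∑⁻-guard (x ≡ᵇ suc k) u v (∑⁺-hit≡∑⁻-hit u v))

multinomial-suc : ∀ n v → multinomial (suc n) v ≡ ∑⁻ (multinomial n) v
multinomial-suc n []          = refl
multinomial-suc n (zero ∷ v)  =
  trans (+-identityʳ _) (trans (multinomial-suc n v) (∑⁻-cong v (λ t _ → sym (multinomial-zero-∷ n t))))
  where
  multinomial-zero-∷ : ∀ n t → multinomial n (zero ∷ t) ≡ multinomial n t
  multinomial-zero-∷ zero    t = +-identityʳ _
  multinomial-zero-∷ (suc n) t = +-identityʳ _
multinomial-suc n (suc k ∷ v) = sym (begin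
  multinomial n (k ∷ v) + ∑⁻ (λ u → multinomial n (suc k ∷ u)) v
    ≡⟨ cong₂ _+_ (multinomial-∷ n k v) (∑⁻-cong v (λ u _ → multinomial-∷ n (suc k) u)) ⟩
  (n C k) * multinomial (n ∸ k) v + ∑⁻ (λ u → (n C suc k) * multinomial (n ∸ suc k) u) v
    ≡⟨ cong ((n C k) * multinomial (n ∸ k) v +_) (∑⁻-*ˡ (n C suc k) (multinomial (n ∸ suc k)) v) ⟩
  (n C k) * multinomial (n ∸ k) v + (n C suc k) * ∑⁻ (multinomial (n ∸ suc k)) v
    ≡⟨ cong ((n C k) * multinomial (n ∸ k) v +_) remaining ⟩
  (n C k) * multinomial (n ∸ k) v + (n C suc k) * multinomial (n ∸ k) v
    ≡⟨ sym (*-distribʳ-+ (multinomial (n ∸ k) v) (n C k) (n C suc k)) ⟩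
  (n C k + n C suc k) * multinomial (n ∸ k) v
    ≡⟨ cong (_* multinomial (n ∸ k) v) (nCk+nC[k+1]≡[n+1]C[k+1] n k) ⟩
  (suc n C suc k) * multinomial (n ∸ k) v ∎)
  where
  open ≡-Reasoning
  multinomial-∷ : ∀ n k ks → multinomial n (k ∷ ks) ≡ (n C k) * multinomial (n ∸ k) ks
  multinomial-∷ zero    k ks = refl
  multinomial-∷ (suc n) k ks = refl
  remaining : (n C suc k) * ∑⁻ (multinomial (n ∸ suc k)) v ≡ (n C suc k) * multinomial (n ∸ k) v
  remaining with suc k ≤? n
  ... | yes k<n = cong ((n C suc k) *_) (trans (sym (multinomial-suc (n ∸ suc k) v))
                                           (cong (λ m → multinomial m v) (sym (+-∸-assoc 1 k<n))))
  ... | no  k≮n rewrite k>n⇒nCk≡0 (≰⇒> k≮n) = refl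

-- column T x = {i : x ∈ Tᵢ} is the Venn region of x, so nu T I counts the x with column T x = I.
column : ∀ {n l} → Vec (Subset n) l → Fin n → Subset l
column T x = tabulate (λ i → lookup (lookup T i) x)

consColumn : ∀ {n l} → Subset l → Vec (Subset n) l → Vec (Subset (suc n)) l
consColumn c T = zipWith _∷_ c T

∑ᶠ : ∀ {n} → (Fin n → ℕ) → ℕ
∑ᶠ f = sum (List.tabulate f)

∑ᶠ-cong : ∀ {n} {f g : Fin n → ℕ} → (∀ x → f x ≡ g x) → ∑ᶠ f ≡ ∑ᶠ g
∑ᶠ-cong f≗g = cong sum (List.tabulate-cong f≗g)

count-tabulate : ∀ {n} (p : A → Bool) (g : Fin n → A) → count p (List.tabulate g) ≡ ∑ᶠ (λ x → 𝟙 (p (g x)))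
count-tabulate {n = zero}  p g = refl
count-tabulate {n = suc n} p g with p (g zero)
... | true  = cong suc (count-tabulate p (λ x → g (suc x)))
... | false = count-tabulate p (λ x → g (suc x))

nu≡∑ᶠ : ∀ {n l} (T : Vec (Subset n) l) I → nu T I ≡ ∑ᶠ (λ x → 𝟙 (column T x ≟ˢ I))
nu≡∑ᶠ T I = count-tabulate (λ x → column T x ≟ˢ I) (λ x → x)

column-consColumn-zero : ∀ {n l} c (T : Vec (Subset n) l) → column (consColumn c T) zero ≡ c
column-consColumn-zero c T =
  trans (Vec.tabulate-cong (λ i → cong (λ S → lookup S zero) (Vec.lookup-zipWith _∷_ i c T))) (Vec.tabulate∘lookup c)

column-consColumn-suc : ∀ {n l} c (T : Vec (Subset n) l) x → column (consColumn c T) (suc x) ≡ column T x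
column-consColumn-suc c T x = Vec.tabulate-cong (λ i → cong (λ S → lookup S (suc x)) (Vec.lookup-zipWith _∷_ i c T))

nu-consColumn : ∀ {n l} c (T : Vec (Subset n) l) I → nu (consColumn c T) I ≡ 𝟙 (c ≟ˢ I) + nu T I
nu-consColumn c T I = trans (nu≡∑ᶠ (consColumn c T) I)
  (cong₂ _+_ (cong (λ S → 𝟙 (S ≟ˢ I)) (column-consColumn-zero c T))
             (trans (∑ᶠ-cong (λ x → cong (λ S → 𝟙 (S ≟ˢ I)) (column-consColumn-suc c T x))) (sym (nu≡∑ᶠ T I))))

map-allSubsets-suc : ∀ l (h : Subset (suc l) → A) →
  map h (allSubsets (suc l)) ≡ map (λ I → h (false ∷ I)) (allSubsets l) ++ map (λ I → h (true ∷ I)) (allSubsets l)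
map-allSubsets-suc l h = trans (List.map-++ h (map (false ∷_) (allSubsets l)) (map (true ∷_) (allSubsets l)))
  (cong₂ _++_ (sym (List.map-∘ (allSubsets l))) (sym (List.map-∘ (allSubsets l))))

∑-allSubsets-∑⁺ : ∀ l (Φ : List ℕ → ℕ) (f : Subset l → ℕ) →
  ∑ (allSubsets l) (λ c → Φ (map (λ I → 𝟙 (c ≟ˢ I) + f I) (allSubsets l))) ≡ ∑⁺ Φ (map f (allSubsets l))
∑-allSubsets-∑⁺ zero    Φ f = refl
∑-allSubsets-∑⁺ (suc l) Φ f = begin
  ∑ (allSubsets (suc l)) (λ c → Φ (map (bump c) (allSubsets (suc l))))
    ≡⟨ ∑-cong (allSubsets (suc l)) (λ c → cong Φ (map-allSubsets-suc l (bump c))) ⟩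
  ∑ (map (false ∷_) E ++ map (true ∷_) E) (λ c → Φ (map (λ I → bump c (false ∷ I)) E ++ map (λ I → bump c (true ∷ I)) E))
    ≡⟨ ∑-++ (map (false ∷_) E) (map (true ∷_) E) _ ⟩
  ∑ (map (false ∷_) E) (λ c → Φ (map (λ I → bump c (false ∷ I)) E ++ map (λ I → bump c (true ∷ I)) E))
   + ∑ (map (true ∷_) E) (λ c → Φ (map (λ I → bump c (false ∷ I)) E ++ map (λ I → bump c (true ∷ I)) E))
    ≡⟨ cong₂ _+_ (∑-map (false ∷_) E _) (∑-map (true ∷_) E _) ⟩
  ∑ E (λ c → Φ (map (λ I → 𝟙 (c ≟ˢ I) + f₀ I) E ++ map f₁ E))
   + ∑ E (λ c → Φ (map f₀ E ++ map (λ I → 𝟙 (c ≟ˢ I) + f₁ I) E))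
    ≡⟨ cong₂ _+_ (∑-allSubsets-∑⁺ l (λ w → Φ (w ++ map f₁ E)) f₀) (∑-allSubsets-∑⁺ l (λ w → Φ (map f₀ E ++ w)) f₁) ⟩
  ∑⁺ (λ w → Φ (w ++ map f₁ E)) (map f₀ E) + ∑⁺ (λ w → Φ (map f₀ E ++ w)) (map f₁ E)
    ≡⟨ sym (∑⁺-++ Φ (map f₀ E) (map f₁ E)) ⟩
  ∑⁺ Φ (map f₀ E ++ map f₁ E)
    ≡⟨ cong (∑⁺ Φ) (sym (map-allSubsets-suc l f)) ⟩
  ∑⁺ Φ (map f (allSubsets (suc l))) ∎
  where
  open ≡-Reasoning
  E = allSubsets l
  bump : Subset (suc l) → Subset (suc l) → ℕ
  bump c I = 𝟙 (c ≟ˢ I) + f I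
  f₀ f₁ : Subset l → ℕ
  f₀ I = f (false ∷ I)
  f₁ I = f (true ∷ I)

∑-allTuples-suc : ∀ l n (h : Vec (Subset (suc n)) l → ℕ) →
  ∑ (allTuples (suc n) l) h ≡ ∑ (allSubsets l) (λ c → ∑ (allTuples n l) (λ T → h (consColumn c T)))
∑-allTuples-suc zero    n h = sym (+-identityʳ _)
∑-allTuples-suc (suc l) n h = begin
  ∑ (allTuples (suc n) (suc l)) h
    ≡⟨ ∑-concatMap (λ S → map (S ∷_) (allTuples (suc n) l)) (allSubsets (suc n)) h ⟩
  ∑ (allSubsets (suc n)) (λ S → ∑ (map (S ∷_) (allTuples (suc n) l)) h)
    ≡⟨ ∑-cong (allSubsets (suc n)) (λ S → trans (∑-map (S ∷_) (allTuples (suc n) l) h) (∑-allTuples-suc l n (λ T → h (S ∷ T)))) ⟩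
  ∑ (allSubsets (suc n)) (λ S → ∑ E (λ c → ∑ Tups (λ T → h (S ∷ consColumn c T))))
    ≡⟨ ∑-++ (map (false ∷_) Rows) (map (true ∷_) Rows) _ ⟩
  ∑ (map (false ∷_) Rows) (λ S → ∑ E (λ c → ∑ Tups (λ T → h (S ∷ consColumn c T))))
   + ∑ (map (true ∷_) Rows) (λ S → ∑ E (λ c → ∑ Tups (λ T → h (S ∷ consColumn c T))))
    ≡⟨ cong₂ _+_ (trans (∑-map (false ∷_) Rows _) (∑-swap Rows E _)) (trans (∑-map (true ∷_) Rows _) (∑-swap Rows E _)) ⟩
  ∑ E (λ c → ∑ Rows (λ S → ∑ Tups (λ T → h ((false ∷ S) ∷ consColumn c T))))
   + ∑ E (λ c → ∑ Rows (λ S → ∑ Tups (λ T → h ((true ∷ S) ∷ consColumn c T))))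
    ≡⟨ cong₂ _+_ (∑-cong E (λ c → sym (first-row false c))) (∑-cong E (λ c → sym (first-row true c))) ⟩
  ∑ E (λ c → ∑ (allTuples n (suc l)) (λ T → h (consColumn (false ∷ c) T)))
   + ∑ E (λ c → ∑ (allTuples n (suc l)) (λ T → h (consColumn (true ∷ c) T)))
    ≡⟨ sym (cong₂ _+_ (∑-map (false ∷_) E _) (∑-map (true ∷_) E _)) ⟩
  ∑ (map (false ∷_) E) (λ c → ∑ (allTuples n (suc l)) (λ T → h (consColumn c T)))
   + ∑ (map (true ∷_) E) (λ c → ∑ (allTuples n (suc l)) (λ T → h (consColumn c T)))
    ≡⟨ sym (∑-++ (map (false ∷_) E) (map (true ∷_) E) _) ⟩
  ∑ (allSubsets (suc l)) (λ c → ∑ (allTuples n (suc l)) (λ T → h (consColumn c T))) ∎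
  where
  open ≡-Reasoning
  Rows = allSubsets n
  E = allSubsets l
  Tups = allTuples n l
  first-row : ∀ b c → ∑ (allTuples n (suc l)) (λ T → h (consColumn (b ∷ c) T))
                    ≡ ∑ Rows (λ S → ∑ Tups (λ T → h ((b ∷ S) ∷ consColumn c T)))
  first-row b c = trans (∑-concatMap (λ S → map (S ∷_) Tups) Rows _) (∑-cong Rows (λ S → ∑-map (S ∷_) Tups _))

∑-allTuples-zero : ∀ l (h : Vec (Subset zero) l → ℕ) → ∑ (allTuples zero l) h ≡ h (Vec.replicate l [])
∑-allTuples-zero zero    h = +-identityʳ _
∑-allTuples-zero (suc l) h = trans (∑-++ (map ([] ∷_) (allTuples zero l)) [] h)
  (trans (+-identityʳ _) (trans (∑-map ([] ∷_) (allTuples zero l) h) (∑-allTuples-zero l (λ T → h ([] ∷ T)))))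

multinomial-zero : ∀ (E : List A) v → length v ≡ length E → 𝟙 (map (λ _ → 0) E ≟ᴸ v) ≡ multinomial 0 v
multinomial-zero []      []          _ = refl
multinomial-zero (_ ∷ E) (zero ∷ v)  e = trans (multinomial-zero E v (suc-injective e)) (sym (+-identityʳ _))
multinomial-zero (_ ∷ E) (suc k ∷ v) _ = refl

count-nuList≡multinomial : ∀ l n v → length v ≡ length (allSubsets l) →
  ∑ (allTuples n l) (λ T → 𝟙 (nuList T ≟ᴸ v)) ≡ multinomial n v
count-nuList≡multinomial l zero    v ∣v∣ = trans (∑-allTuples-zero l _) (multinomial-zero (allSubsets l) v ∣v∣)
count-nuList≡multinomial l (suc n) v ∣v∣ = begin
  ∑ (allTuples (suc n) l) (λ T → 𝟙 (nuList T ≟ᴸ v))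
    ≡⟨ ∑-allTuples-suc l n _ ⟩
  ∑ E (λ c → ∑ Tups (λ T → 𝟙 (nuList (consColumn c T) ≟ᴸ v)))
    ≡⟨ ∑-cong E (λ c → ∑-cong Tups (λ T → cong (λ w → 𝟙 (w ≟ᴸ v)) (List.map-cong (nu-consColumn c T) E))) ⟩
  ∑ E (λ c → ∑ Tups (λ T → 𝟙 (map (λ I → 𝟙 (c ≟ˢ I) + nu T I) E ≟ᴸ v)))
    ≡⟨ ∑-swap E Tups _ ⟩
  ∑ Tups (λ T → ∑ E (λ c → 𝟙 (map (λ I → 𝟙 (c ≟ˢ I) + nu T I) E ≟ᴸ v)))
    ≡⟨ ∑-cong Tups (λ T → ∑-allSubsets-∑⁺ l (λ w → 𝟙 (w ≟ᴸ v)) (nu T)) ⟩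
  ∑ Tups (λ T → ∑⁺ (λ w → 𝟙 (w ≟ᴸ v)) (nuList T))
    ≡⟨ ∑-cong Tups (λ T → ∑⁺-hit≡∑⁻-hit (nuList T) v) ⟩
  ∑ Tups (λ T → ∑⁻ (λ t → 𝟙 (nuList T ≟ᴸ t)) v)
    ≡⟨ ∑-∑⁻ Tups (λ T t → 𝟙 (nuList T ≟ᴸ t)) v ⟩
  ∑⁻ (λ t → ∑ Tups (λ T → 𝟙 (nuList T ≟ᴸ t))) v
    ≡⟨ ∑⁻-cong v (λ t ∣t∣ → count-nuList≡multinomial l n t (trans ∣t∣ ∣v∣)) ⟩
  ∑⁻ (multinomial n) v
    ≡⟨ sym (multinomial-suc n v) ⟩
  multinomial (suc n) v ∎
  where
  open ≡-Reasoning
  E = allSubsets l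
  Tups = allTuples n l

-- The Venn counts determine membership in L̃

∑-allSubsets-at : ∀ l J (h : Subset l → ℕ) → ∑ (allSubsets l) (λ I → 𝟙 (J ≟ˢ I) * h I) ≡ h J
∑-allSubsets-at zero    []      h = trans (+-identityʳ _) (+-identityʳ _)
∑-allSubsets-at (suc l) (b ∷ J) h =
  trans (∑-++ (map (false ∷_) E) (map (true ∷_) E) _)
        (trans (cong₂ _+_ (∑-map (false ∷_) E _) (∑-map (true ∷_) E _)) (halves b))
  where
  E = allSubsets l
  halves : ∀ b → ∑ E (λ I → 𝟙 ((b ∷ J) ≟ˢ (false ∷ I)) * h (false ∷ I))
               + ∑ E (λ I → 𝟙 ((b ∷ J) ≟ˢ (true ∷ I)) * h (true ∷ I)) ≡ h (b ∷ J)
  halves false = trans (cong₂ _+_ (∑-allSubsets-at l J (λ I → h (false ∷ I))) (∑-zero E)) (+-identityʳ _)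
  halves true  = cong₂ _+_ (∑-zero E) (∑-allSubsets-at l J (λ I → h (true ∷ I)))

∑ᶠ-∑ : ∀ {n} (E : List A) (h : Fin n → A → ℕ) → ∑ᶠ (λ x → ∑ E (h x)) ≡ ∑ E (λ I → ∑ᶠ (λ x → h x I))
∑ᶠ-∑ {n = zero}  E h = sym (∑-zero E)
∑ᶠ-∑ {n = suc n} E h =
  trans (cong (∑ E (h zero) +_) (∑ᶠ-∑ E (λ x → h (suc x)))) (sym (∑-+ E (h zero) (λ I → ∑ᶠ (λ x → h (suc x) I))))

∑ᶠ-*ʳ : ∀ {n} (h : Fin n → ℕ) c → ∑ᶠ (λ x → h x * c) ≡ ∑ᶠ h * c
∑ᶠ-*ʳ {zero}  h c = refl
∑ᶠ-*ʳ {suc n} h c = trans (cong (h zero * c +_) (∑ᶠ-*ʳ (λ x → h (suc x)) c)) (sym (*-distribʳ-+ c (h zero) _))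

∑ᶠ-column≡∑-nu : ∀ {n l} (T : Vec (Subset n) l) (h : Subset l → ℕ) →
  ∑ᶠ (λ x → h (column T x)) ≡ ∑ (allSubsets l) (λ I → h I * nu T I)
∑ᶠ-column≡∑-nu {n} {l} T h = begin
  ∑ᶠ (λ x → h (column T x))
    ≡⟨ ∑ᶠ-cong (λ x → sym (∑-allSubsets-at l (column T x) h)) ⟩
  ∑ᶠ (λ x → ∑ E (λ I → 𝟙 (column T x ≟ˢ I) * h I))
    ≡⟨ ∑ᶠ-∑ {n = n} E (λ x I → 𝟙 (column T x ≟ˢ I) * h I) ⟩
  ∑ E (λ I → ∑ᶠ (λ x → 𝟙 (column T x ≟ˢ I) * h I))
    ≡⟨ ∑-cong E (λ I → trans (∑ᶠ-*ʳ {n} (λ x → 𝟙 (column T x ≟ˢ I)) (h I))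
                             (trans (*-comm _ (h I)) (cong (h I *_) (sym (nu≡∑ᶠ T I))))) ⟩
  ∑ E (λ I → h I * nu T I) ∎
  where
  open ≡-Reasoning
  E = allSubsets l

map-≡⇒≡-∈ : ∀ {f g : A → B} xs → map f xs ≡ map g xs → ∀ x → x ∈ xs → f x ≡ g x
map-≡⇒≡-∈ (y ∷ xs) eq x (here refl) = List.∷-injectiveˡ eq
map-≡⇒≡-∈ (y ∷ xs) eq x (there x∈) = map-≡⇒≡-∈ xs (List.∷-injectiveʳ eq) x x∈

∑ᶠ-column-nuList : ∀ {n l} (T T′ : Vec (Subset n) l) → nuList T ≡ nuList T′ →
  ∀ h → ∑ᶠ (λ x → h (column T x)) ≡ ∑ᶠ (λ x → h (column T′ x))
∑ᶠ-column-nuList {l = l} T T′ eq h =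
  trans (∑ᶠ-column≡∑-nu T h)
        (trans (∑-cong-∈ (allSubsets l) (λ I I∈ → cong (h I *_) (map-≡⇒≡-∈ (allSubsets l) eq I I∈)))
               (sym (∑ᶠ-column≡∑-nu T′ h)))

∣∣≡∑ᶠ : ∀ {n} (S : Subset n) → ∣ S ∣ ≡ ∑ᶠ (λ x → 𝟙 (lookup S x))
∣∣≡∑ᶠ []          = refl
∣∣≡∑ᶠ (true ∷ S)  = cong suc (∣∣≡∑ᶠ S)
∣∣≡∑ᶠ (false ∷ S) = ∣∣≡∑ᶠ S

lookup-column : ∀ {n l} (T : Vec (Subset n) l) i x → lookup (column T x) i ≡ lookup (lookup T i) x
lookup-column T i x = Vec.lookup∘tabulate (λ j → lookup (lookup T j) x) i

select : ∀ {l} → Subset l → Vec A l → List A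
select []          []       = []
select (true ∷ m)  (x ∷ xs) = x ∷ select m xs
select (false ∷ m) (x ∷ xs) = select m xs

_⊆ᵇ_ : ∀ {l} → Subset l → Subset l → Bool
[]          ⊆ᵇ []       = true
(true ∷ m)  ⊆ᵇ (c ∷ cs) = c ∧ (m ⊆ᵇ cs)
(false ∷ m) ⊆ᵇ (c ∷ cs) = m ⊆ᵇ cs

lookup-⋂-select : ∀ {n l} m (T : Vec (Subset n) l) x → lookup (⋂ (select m T)) x ≡ m ⊆ᵇ column T x
lookup-⋂-select []          []      x = Vec.lookup-replicate x inside
lookup-⋂-select (true ∷ m)  (X ∷ T) x =
  trans (Vec.lookup-zipWith _∧_ x X (⋂ (select m T))) (cong (lookup X x ∧_) (lookup-⋂-select m T x))
lookup-⋂-select (false ∷ m) (X ∷ T) x = lookup-⋂-select m T x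

≟ˢ≡no-difference : ∀ {n} (S S′ : Subset n) → (S ≟ˢ S′) ≡ (∑ᶠ (λ x → 𝟙 (lookup S x xor lookup S′ x)) ≡ᵇ 0)
≟ˢ≡no-difference []          []           = refl
≟ˢ≡no-difference (true ∷ S)  (true ∷ S′)  = ≟ˢ≡no-difference S S′
≟ˢ≡no-difference (false ∷ S) (false ∷ S′) = ≟ˢ≡no-difference S S′
≟ˢ≡no-difference (true ∷ S)  (false ∷ S′) = refl
≟ˢ≡no-difference (false ∷ S) (true ∷ S′)  = refl

module SameNuList {n l} (T T′ : Vec (Subset n) l) (eq : nuList T ≡ nuList T′) where

  private
    same-count : ∀ (g : Subset l → Bool) → ∑ᶠ (λ x → 𝟙 (g (column T x))) ≡ ∑ᶠ (λ x → 𝟙 (g (column T′ x)))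
    same-count g = ∑ᶠ-column-nuList T T′ eq (λ c → 𝟙 (g c))

    count-row : ∀ (U : Vec (Subset n) l) i → ∣ lookup U i ∣ ≡ ∑ᶠ (λ x → 𝟙 (lookup (column U x) i))
    count-row U i = trans (∣∣≡∑ᶠ (lookup U i)) (∑ᶠ-cong (λ x → cong 𝟙 (sym (lookup-column U i x))))

    count-⋂ : ∀ (U : Vec (Subset n) l) m → ∣ ⋂ (select m U) ∣ ≡ ∑ᶠ (λ x → 𝟙 (m ⊆ᵇ column U x))
    count-⋂ U m = trans (∣∣≡∑ᶠ (⋂ (select m U))) (∑ᶠ-cong (λ x → cong 𝟙 (lookup-⋂-select m U x)))

    count-difference : ∀ (U : Vec (Subset n) l) i j →
      ∑ᶠ (λ x → 𝟙 (lookup (lookup U i) x xor lookup (lookup U j) x))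
        ≡ ∑ᶠ (λ x → 𝟙 (lookup (column U x) i xor lookup (column U x) j))
    count-difference U i j = ∑ᶠ-cong (λ x → sym (cong₂ (λ a b → 𝟙 (a xor b)) (lookup-column U i x) (lookup-column U j x)))

  same-∣row∣ : ∀ i → ∣ lookup T i ∣ ≡ ∣ lookup T′ i ∣
  same-∣row∣ i = trans (count-row T i) (trans (same-count (λ c → lookup c i)) (sym (count-row T′ i)))

  same-∣⋂∣ : ∀ m → ∣ ⋂ (select m T) ∣ ≡ ∣ ⋂ (select m T′) ∣
  same-∣⋂∣ m = trans (count-⋂ T m) (trans (same-count (m ⊆ᵇ_)) (sym (count-⋂ T′ m)))

  same-≟ˢ : ∀ i j → (lookup T i ≟ˢ lookup T j) ≡ (lookup T′ i ≟ˢ lookup T′ j)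
  same-≟ˢ i j = begin
    lookup T i ≟ˢ lookup T j
      ≡⟨ ≟ˢ≡no-difference (lookup T i) (lookup T j) ⟩
    ∑ᶠ (λ x → 𝟙 (lookup (lookup T i) x xor lookup (lookup T j) x)) ≡ᵇ 0
      ≡⟨ cong (_≡ᵇ 0) (trans (count-difference T i j)
                       (trans (same-count (λ c → lookup c i xor lookup c j)) (sym (count-difference T′ i j)))) ⟩
    ∑ᶠ (λ x → 𝟙 (lookup (lookup T′ i) x xor lookup (lookup T′ j) x)) ≡ᵇ 0
      ≡⟨ sym (≟ˢ≡no-difference (lookup T′ i) (lookup T′ j)) ⟩
    lookup T′ i ≟ˢ lookup T′ j ∎
    where open ≡-Reasoning

map-toList-cong : ∀ {l} {f f′ : A → B} (v v′ : Vec A l) →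
  (∀ i → f (lookup v i) ≡ f′ (lookup v′ i)) → map f (toList v) ≡ map f′ (toList v′)
map-toList-cong []      []        _  = refl
map-toList-cong (x ∷ v) (x′ ∷ v′) eq = cong₂ _∷_ (eq zero) (map-toList-cong v v′ (λ i → eq (suc i)))

pairwiseDistinct-cong : ∀ {n l} (v v′ : Vec (Subset n) l) →
  (∀ i j → (lookup v i ≟ˢ lookup v j) ≡ (lookup v′ i ≟ˢ lookup v′ j)) →
  pairwiseDistinct (toList v) ≡ pairwiseDistinct (toList v′)
pairwiseDistinct-cong []      []        _  = refl
pairwiseDistinct-cong (x ∷ v) (x′ ∷ v′) eq =
  cong₂ (λ a b → not a ∧ b) (cong or (map-toList-cong v v′ (λ j → eq zero (suc j))))
                             (pairwiseDistinct-cong v v′ (λ i j → eq (suc i) (suc j)))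

sublists-toList : ∀ {l} (v : Vec A l) → sublists (toList v) ≡ map (λ m → select m v) (allSubsets l)
sublists-toList []                  = refl
sublists-toList {l = suc l} (x ∷ v) =
  trans (cong (λ S → S ++ map (x ∷_) S) (sublists-toList v))
        (trans (cong (map (λ m → select m v) (allSubsets l) ++_) (sym (List.map-∘ (allSubsets l))))
               (sym (map-allSubsets-suc l (λ m → select m (x ∷ v)))))

length-select : ∀ {l} m (v : Vec A l) → length (select m v) ≡ ∣ m ∣
length-select []          []      = refl
length-select (true ∷ m)  (x ∷ v) = cong suc (length-select m v)
length-select (false ∷ m) (x ∷ v) = length-select m v

rho-select : ∀ {n l} d m (v v′ : Vec (Subset n) l) → (∀ i → ∣ lookup v i ∣ ≡ ∣ lookup v′ i ∣) →
  rho d (select m v) ≡ rho d (select m v′)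
rho-select d []          []      []         _  = refl
rho-select d (true ∷ m)  (x ∷ v) (x′ ∷ v′) eq =
  cong₂ ℤ._+_ (cong (λ k → ℤ.+ suc d ℤ.- ℤ.+ k) (eq zero)) (rho-select d m v v′ (λ i → eq (suc i)))
rho-select d (false ∷ m) (x ∷ v) (x′ ∷ v′) eq = rho-select d m v v′ (λ i → eq (suc i))

-- isL d F unfolds to  all (λ X → ∣ X ∣ ≤ᵇ d) F ∧ all (admissible d) (sublists F).
admissible : ∀ {n} → ℕ → List (Subset n) → Bool
admissible d F = (length F ≤ᵇ 1) Bool.∨ ⌊ +0 ℤ.<? D d F ⌋

inLtilde : ∀ {n} d (γ : List ℕ) → Vec (Subset n) (length γ) → Bool
inLtilde d γ T = pairwiseDistinct (toList T) ∧ isL d (toList T) ∧ (map (codimℕ d) (toList T) ≟ᴸ γ)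

inLtilde-nuList : ∀ {n} d γ (T T′ : Vec (Subset n) (length γ)) → nuList T ≡ nuList T′ →
  inLtilde d γ T ≡ inLtilde d γ T′
inLtilde-nuList {n} d γ T T′ eq =
  cong₂ _∧_ (pairwiseDistinct-cong T T′ (same-≟ˢ))
    (cong₂ _∧_ (cong₂ _∧_ (cong and (map-toList-cong T T′ (λ i → cong (_≤ᵇ d) (same-∣row∣ i))))
                          (cong and sub-families))
               (cong (_≟ᴸ γ) (map-toList-cong T T′ (λ i → cong (suc d ∸_) (same-∣row∣ i)))))
  where
  open SameNuList T T′ eq
  E = allSubsets (length γ)
  select-admissible : ∀ m → admissible d (select m T) ≡ admissible d (select m T′)
  select-admissible m = cong₂ (λ k z → (k ≤ᵇ 1) Bool.∨ ⌊ +0 ℤ.<? z ⌋)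
    (trans (length-select m T) (sym (length-select m T′)))
    (cong₂ ℤ._-_ (cong (λ k → ℤ.+ suc d ℤ.- ℤ.+ k) (same-∣⋂∣ m)) (rho-select d m T T′ same-∣row∣))
  sub-families : map (admissible d) (sublists (toList T)) ≡ map (admissible d) (sublists (toList T′))
  sub-families = begin
    map (admissible d) (sublists (toList T))       ≡⟨ cong (map (admissible d)) (sublists-toList T) ⟩
    map (admissible d) (map (λ m → select m T) E)  ≡⟨ sym (List.map-∘ E) ⟩
    map (λ m → admissible d (select m T)) E        ≡⟨ List.map-cong select-admissible E ⟩
    map (λ m → admissible d (select m T′)) E       ≡⟨ List.map-∘ E ⟩
    map (admissible d) (map (λ m → select m T′) E) ≡⟨ cong (map (admissible d)) (sym (sublists-toList T′)) ⟩
    map (admissible d) (sublists (toList T′))      ∎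
    where open ≡-Reasoning

private
  _≟ℕs_ = List.≡-dec ℕ._≟_

-- Membership in L̃ depends only on ν_T and ν is realised in L̃, so every tuple with ν_T = ν lies in L̃.
multiplicity-nuList : ∀ n d γ v → v ∈ Nset n d γ → multiplicity _≟ℕs_ v (map nuList (Ltilde n d γ)) ≡ multinomial n v
multiplicity-nuList n d γ v v∈N with ∈-map⁻ nuList (∈-deduplicate⁻ _≟ℕs_ (map nuList (Ltilde n d γ)) v∈N)
... | T₀ , T₀∈ , refl = begin
  ∑ (map nuList (Ltilde n d γ)) (λ w → 𝟙 (does (nuList T₀ ≟ℕs w)))
    ≡⟨ ∑-map nuList (Ltilde n d γ) _ ⟩
  ∑ (Ltilde n d γ) (λ T → 𝟙 (does (nuList T₀ ≟ℕs nuList T)))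
    ≡⟨ ∑-filter (λ T → Bool.T? (inLtilde d γ T)) Tups _ ⟩
  ∑ Tups (λ T → 𝟙 (inLtilde d γ T) * 𝟙 (does (nuList T₀ ≟ℕs nuList T)))
    ≡⟨ ∑-cong Tups only-nuList ⟩
  ∑ Tups (λ T → 𝟙 (nuList T ≟ᴸ nuList T₀))
    ≡⟨ count-nuList≡multinomial (length γ) n (nuList T₀) (List.length-map (nu T₀) (allSubsets (length γ))) ⟩
  multinomial n (nuList T₀) ∎
  where
  open ≡-Reasoning
  Tups = allTuples n (length γ)
  T₀-in : inLtilde d γ T₀ ≡ true
  T₀-in = Equivalence.to Bool.T-≡ (proj₂ (∈-filter⁻ (λ T → Bool.T? (inLtilde d γ T)) {xs = Tups} T₀∈))
  only-nuList : ∀ T → 𝟙 (inLtilde d γ T) * 𝟙 (does (nuList T₀ ≟ℕs nuList T)) ≡ 𝟙 (nuList T ≟ᴸ nuList T₀)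
  only-nuList T with nuList T ≟ℕs nuList T₀
  ... | yes same = cong₂ (λ a b → 𝟙 a * 𝟙 b) (trans (inLtilde-nuList d γ T T₀ same) T₀-in)
                                             (dec-true (nuList T₀ ≟ℕs nuList T) (sym same))
  ... | no  diff = trans (cong (λ b → 𝟙 (inLtilde d γ T) * 𝟙 b) (dec-false (nuList T₀ ≟ℕs nuList T) (diff ∘ sym)))
                         (*-zeroʳ (𝟙 (inLtilde d γ T)))

length-Ltilde≡∑-multinomial : ∀ n d γ → length (Ltilde n d γ) ≡ sum (map (multinomial n) (Nset n d γ))
length-Ltilde≡∑-multinomial n d γ =
  trans (sym (List.length-map nuList (Ltilde n d γ)))
        (trans (length≡∑-multiplicity _≟ℕs_ (map nuList (Ltilde n d γ)))
               (∑-cong-∈ (Nset n d γ) (multiplicity-nuList n d γ)))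

≡ᵇ-reflects-≡ : ∀ m n → Reflects (m ≡ n) (m ≡ᵇ n)
≡ᵇ-reflects-≡ m n = proof (m ℕ.≟ n)

≡ᵇ-refl : ∀ m → (m ≡ᵇ m) ≡ true
≡ᵇ-refl zero    = refl
≡ᵇ-refl (suc m) = ≡ᵇ-refl m

mult-∷ : ∀ a g γ → mult a (g ∷ γ) ≡ 𝟙 (g ≡ᵇ a) + mult a γ
mult-∷ a g γ with g ≡ᵇ a
... | true  = refl
... | false = refl

remove : ℕ → List ℕ → List ℕ
remove a []      = []
remove a (g ∷ γ) = if g ≡ᵇ a then γ else g ∷ remove a γ

_≥ʰ_ : ℕ → List ℕ → Set
x ≥ʰ []      = ⊤
x ≥ʰ (y ∷ _) = y ≤ x

Descending : List ℕ → Set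
Descending []       = ⊤
Descending (x ∷ ys) = x ≥ʰ ys × Descending ys

insertDesc-≥ʰ : ∀ a x ys → x ≥ʰ ys → a ≤ x → x ≥ʰ insertDesc a ys
insertDesc-≥ʰ a x []       _    a≤x = a≤x
insertDesc-≥ʰ a x (y ∷ ys) y≤x a≤x with y ≤ᵇ a
... | true  = a≤x
... | false = y≤x

insertDesc-descending : ∀ a p → Descending p → Descending (insertDesc a p)
insertDesc-descending a []       _          = tt , tt
insertDesc-descending a (y ∷ ys) (y≥ , ys↓) with y ≤ᵇ a | ≤ᵇ-reflects-≤ y a
... | true  | ofʸ y≤a = y≤a , y≥ , ys↓
... | false | ofⁿ y≰a = insertDesc-≥ʰ a y ys y≥ (<⇒≤ (≰⇒> y≰a)) , insertDesc-descending a ys ys↓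

sortDesc-descending : ∀ xs → Descending (sortDesc xs)
sortDesc-descending []       = tt
sortDesc-descending (x ∷ xs) = insertDesc-descending x (sortDesc xs) (sortDesc-descending xs)

remove-insertDesc : ∀ a p → remove a (insertDesc a p) ≡ p
remove-insertDesc a []       rewrite ≡ᵇ-refl a = refl
remove-insertDesc a (y ∷ ys) with y ≤ᵇ a | ≤ᵇ-reflects-≤ y a
... | true  | _       rewrite ≡ᵇ-refl a = refl
... | false | ofⁿ y≰a with y ≡ᵇ a | ≡ᵇ-reflects-≡ y a
...   | true  | ofʸ refl = contradiction ≤-refl y≰a
...   | false | _        = cong (y ∷_) (remove-insertDesc a ys)

mult-insertDesc : ∀ a p → mult a (insertDesc a p) ≡ suc (mult a p)
mult-insertDesc a []       rewrite ≡ᵇ-refl a = refl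
mult-insertDesc a (y ∷ ys) with y ≤ᵇ a
... | true  rewrite ≡ᵇ-refl a = refl
... | false = trans (mult-∷ a y (insertDesc a ys))
               (trans (cong (𝟙 (y ≡ᵇ a) +_) (mult-insertDesc a ys))
                      (trans (+-suc (𝟙 (y ≡ᵇ a)) (mult a ys)) (cong suc (sym (mult-∷ a y ys)))))

occurs⇒≤head : ∀ a g γ → g ≥ʰ γ → Descending γ → 1 ≤ mult a γ → a ≤ g
occurs⇒≤head a g (y ∷ ys) y≤g (y≥ , ys↓) a∈ with y ≡ᵇ a | ≡ᵇ-reflects-≡ y a
... | true  | ofʸ refl = y≤g
... | false | _        = ≤-trans (occurs⇒≤head a y ys y≥ ys↓ a∈) y≤g

insertDesc-head : ∀ a γ → a ≥ʰ γ → insertDesc a γ ≡ a ∷ γ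
insertDesc-head a []       _   = refl
insertDesc-head a (y ∷ ys) y≤a with y ≤ᵇ a | ≤ᵇ-reflects-≤ y a
... | true  | _       = refl
... | false | ofⁿ y≰a = contradiction y≤a y≰a

insertDesc-remove : ∀ a γ → Descending γ → 1 ≤ mult a γ → insertDesc a (remove a γ) ≡ γ
insertDesc-remove a (g ∷ γ) (g≥ , γ↓) a∈ with g ≡ᵇ a | ≡ᵇ-reflects-≡ g a
... | true  | ofʸ refl = insertDesc-head g γ g≥
... | false | ofⁿ g≢a with g ≤ᵇ a | ≤ᵇ-reflects-≤ g a
...   | true  | ofʸ g≤a = contradiction (≤-antisym g≤a (occurs⇒≤head a g γ g≥ γ↓ a∈)) g≢a
...   | false | _       = cong (g ∷_) (insertDesc-remove a γ γ↓ a∈)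

remove-≥ʰ : ∀ a g γ → g ≥ʰ γ → Descending γ → g ≥ʰ remove a γ
remove-≥ʰ a g []           _   _          = tt
remove-≥ʰ a g (y ∷ [])     y≤g _          with y ≡ᵇ a
... | true  = tt
... | false = y≤g
remove-≥ʰ a g (y ∷ z ∷ zs) y≤g (z≤y , _) with y ≡ᵇ a
... | true  = ≤-trans z≤y y≤g
... | false = y≤g

remove-descending : ∀ a γ → Descending γ → Descending (remove a γ)
remove-descending a []      _          = tt
remove-descending a (g ∷ γ) (g≥ , γ↓) with g ≡ᵇ a
... | true  = γ↓
... | false = remove-≥ʰ a g γ g≥ γ↓ , remove-descending a γ γ↓

insertDesc-≟ᴸ : ∀ a p γ → Descending γ → (insertDesc a p ≟ᴸ γ) ≡ ((0 <ᵇ mult a γ) ∧ (p ≟ᴸ remove a γ))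
insertDesc-≟ᴸ a p γ γ↓ with List.≡-dec ℕ._≟_ (insertDesc a p) γ
... | yes refl rewrite mult-insertDesc a p | remove-insertDesc a p = sym (dec-true (List.≡-dec ℕ._≟_ p p) refl)
... | no  ≢γ with 0 <ᵇ mult a γ | <ᵇ-reflects-< 0 (mult a γ)
...   | false | _        = refl
...   | true  | ofʸ a∈γ with List.≡-dec ℕ._≟_ p (remove a γ)
...     | yes refl = contradiction (insertDesc-remove a γ γ↓ a∈γ) ≢γ
...     | no  _    = refl

remove-↭ : ∀ a γ → mult a γ ≡ 0 ⊎ γ ↭ a ∷ remove a γ
remove-↭ a []      = inj₁ refl
remove-↭ a (g ∷ γ) with g ≡ᵇ a | ≡ᵇ-reflects-≡ g a
... | true  | ofʸ refl = inj₂ ↭.refl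
... | false | _ with remove-↭ a γ
...   | inj₁ none = inj₁ none
...   | inj₂ γ↭   = inj₂ (↭.trans (prep g γ↭) (swap g a ↭.refl))

mult-remove-≢ : ∀ a g γ → g ≢ a → mult g (remove a γ) ≡ mult g γ
mult-remove-≢ a g []       _   = refl
mult-remove-≢ a g (y ∷ ys) g≢a with y ≡ᵇ a | ≡ᵇ-reflects-≡ y a
... | true  | ofʸ refl with y ≡ᵇ g | ≡ᵇ-reflects-≡ y g
...   | true  | ofʸ refl = contradiction refl g≢a
...   | false | _        = refl
mult-remove-≢ a g (y ∷ ys) g≢a | false | _ =
  trans (mult-∷ g y (remove a ys)) (trans (cong (𝟙 (y ≡ᵇ g) +_) (mult-remove-≢ a g ys g≢a)) (sym (mult-∷ g y ys)))

-- ∏ₛ mₛ(γ)!, computed by letting each entry count the equal entries after it.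
multFact : List ℕ → ℕ
multFact []      = 1
multFact (a ∷ γ) = suc (mult a γ) * multFact γ

multFact-remove : ∀ a γ → 1 ≤ mult a γ → multFact γ ≡ mult a γ * multFact (remove a γ)
multFact-remove a (g ∷ γ) a∈ with g ≡ᵇ a | ≡ᵇ-reflects-≡ g a
... | true  | ofʸ refl = refl
... | false | ofⁿ g≢a  rewrite mult-remove-≢ a g γ g≢a | multFact-remove a γ a∈ =
  *-left-comm (suc (mult g γ)) (mult a γ) (multFact (remove a γ))

𝟙-occurs-multFact : ∀ a γ → 𝟙 (0 <ᵇ mult a γ) * multFact γ ≡ mult a γ * multFact (remove a γ)
𝟙-occurs-multFact a γ with mult a γ in eq
... | zero  = refl
... | suc k = trans (+-identityʳ (multFact γ))
                    (trans (multFact-remove a γ (subst (1 ≤_) (sym eq) (s≤s z≤n))) (cong (_* multFact (remove a γ)) eq))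

applyUpTo-cong : ∀ N {f g : ℕ → A} → (∀ s → f s ≡ g s) → applyUpTo f N ≡ applyUpTo g N
applyUpTo-cong zero    _   = refl
applyUpTo-cong (suc N) f≗g = cong₂ _∷_ (f≗g 0) (applyUpTo-cong N (λ s → f≗g (suc s)))

product-applyUpTo-1 : ∀ N → product (applyUpTo (λ _ → 1) N) ≡ 1
product-applyUpTo-1 zero    = refl
product-applyUpTo-1 (suc N) = trans (+-identityʳ _) (product-applyUpTo-1 N)

product-applyUpTo-! : ∀ N a (m : ℕ → ℕ) → a < N →
  product (applyUpTo (λ s → (𝟙 (a ≡ᵇ s) + m s) !) N) ≡ suc (m a) * product (applyUpTo (λ s → m s !) N)
product-applyUpTo-! (suc N) zero    m _         = *-assoc (suc (m 0)) (m 0 !) _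
product-applyUpTo-! (suc N) (suc a) m (s≤s a<N) =
  trans (cong (m 0 ! *_) (product-applyUpTo-! N a (λ s → m (suc s)) a<N)) (*-left-comm (m 0 !) (suc (m (suc a))) _)

product-applyUpTo-mult! : ∀ N γ → All (λ x → 1 ≤ x) γ → All (_≤ N) γ →
  product (applyUpTo (λ s → mult (suc s) γ !) N) ≡ multFact γ
product-applyUpTo-mult! N []          _            _           = product-applyUpTo-1 N
product-applyUpTo-mult! N (suc a ∷ γ) (_ ∷ γ-pos) (a<N ∷ γ≤N) =
  trans (cong product (applyUpTo-cong N (λ s → cong _! (mult-∷ (suc s) (suc a) γ))))
  (trans (product-applyUpTo-! N a (λ s → mult (suc s) γ) a<N)
         (cong (suc (mult (suc a) γ) *_) (product-applyUpTo-mult! N γ γ-pos γ≤N)))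

multFactProd≡multFact : ∀ γ → All (λ x → 1 ≤ x) γ → multFactProd γ ≡ multFact γ
multFactProd≡multFact γ γ-pos =
  trans (cong product (List.map-upTo (λ s → mult (suc s) γ !) (sum γ)))
        (product-applyUpTo-mult! (sum γ) γ γ-pos (≤-sum γ ≤-refl))
  where
  ≤-sum : ∀ δ {N} → sum δ ≤ N → All (_≤ N) δ
  ≤-sum []      _ = []
  ≤-sum (a ∷ δ) p = m+n≤o⇒m≤o a p ∷ ≤-sum δ (m+n≤o⇒n≤o a p)

insertDesc-All : ∀ {P : ℕ → Set} a p → P a → All P p → All P (insertDesc a p)
insertDesc-All a []       Pa []         = Pa ∷ []
insertDesc-All a (y ∷ ys) Pa (Py ∷ Pys) with y ≤ᵇ a
... | true  = Pa ∷ Py ∷ Pys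
... | false = Py ∷ insertDesc-All a ys Pa Pys

sortDesc-All : ∀ {P : ℕ → Set} xs → All P xs → All P (sortDesc xs)
sortDesc-All []       []         = []
sortDesc-All (x ∷ xs) (Px ∷ Pxs) = insertDesc-All x (sortDesc xs) Px (sortDesc-All xs Pxs)

-- Ordered selections versus families

any-↭ : ∀ (f : A → Bool) {xs ys} → xs ↭ ys → any f xs ≡ any f ys
any-↭ f p = foldr-commMonoid (setoid Bool) ∨-isCommutativeMonoid (↭⇒↭ₛ (↭.map⁺ f p))

all-↭ : ∀ (f : A → Bool) {xs ys} → xs ↭ ys → all f xs ≡ all f ys
all-↭ f p = foldr-commMonoid (setoid Bool) ∧-isCommutativeMonoid (↭⇒↭ₛ (↭.map⁺ f p))

module OrderedCount {A : Set} (_≟_ : DecidableEquality A) (w : A → ℕ) where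

  _∉ᵇ_ : A → List A → Bool
  x ∉ᵇ xs = not (any (λ y → does (x ≟ y)) xs)

  extend : (List A → ℕ) → A → List A → ℕ
  extend Ψ x xs = 𝟙 (x ∉ᵇ xs) * Ψ (x ∷ xs)

  -- ∑tuples U Ψ γ sums Ψ (x₁ ∷ … ∷ xₗ) over the tuples of distinct xᵢ ∈ U with w xᵢ = γᵢ.
  ∑tuples : List A → (List A → ℕ) → List ℕ → ℕ
  ∑tuples U Ψ []      = Ψ []
  ∑tuples U Ψ (g ∷ γ) = ∑ U (λ x → 𝟙 (w x ≡ᵇ g) * ∑tuples U (extend Ψ x) γ)

  ∑families : List A → (List A → ℕ) → List ℕ → ℕ
  ∑families U Ψ γ = ∑ (sublists U) (λ F → 𝟙 (sortDesc (map w F) ≟ᴸ γ) * Ψ F)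

  PermutationInvariant : (List A → ℕ) → Set
  PermutationInvariant Ψ = ∀ {xs ys} → xs ↭ ys → Ψ xs ≡ Ψ ys

  ∑tuples-cong : ∀ U γ {Ψ Ψ′} → (∀ xs → Ψ xs ≡ Ψ′ xs) → ∑tuples U Ψ γ ≡ ∑tuples U Ψ′ γ
  ∑tuples-cong U []      Ψ≗Ψ′ = Ψ≗Ψ′ []
  ∑tuples-cong U (g ∷ γ) Ψ≗Ψ′ =
    ∑-cong U (λ x → cong (𝟙 (w x ≡ᵇ g) *_) (∑tuples-cong U γ (λ xs → cong (𝟙 (x ∉ᵇ xs) *_) (Ψ≗Ψ′ (x ∷ xs)))))

  ∑tuples-zero : ∀ U γ → ∑tuples U (λ _ → 0) γ ≡ 0
  ∑tuples-zero U []      = refl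
  ∑tuples-zero U (g ∷ γ) = trans (∑-cong U vanish) (∑-zero U)
    where
    vanish : ∀ x → 𝟙 (w x ≡ᵇ g) * ∑tuples U (extend (λ _ → 0) x) γ ≡ 0
    vanish x = trans (cong (𝟙 (w x ≡ᵇ g) *_) (trans (∑tuples-cong U γ (λ xs → *-zeroʳ (𝟙 (x ∉ᵇ xs)))) (∑tuples-zero U γ)))
                     (*-zeroʳ (𝟙 (w x ≡ᵇ g)))

  extend-invariant : ∀ {Ψ} → PermutationInvariant Ψ → ∀ x → PermutationInvariant (extend Ψ x)
  extend-invariant Ψ-inv x p = cong₂ _*_ (cong (𝟙 ∘ not) (any-↭ (λ y → does (x ≟ y)) p)) (Ψ-inv (prep x p))

  private
    𝟙-∉ᵇ-swap : ∀ a b c m → 𝟙 (not b) * (𝟙 (not (a ∨ c)) * m) ≡ 𝟙 (not c) * (𝟙 (not (a ∨ b)) * m)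
    𝟙-∉ᵇ-swap true  b     c     m = trans (*-zeroʳ (𝟙 (not b))) (sym (*-zeroʳ (𝟙 (not c))))
    𝟙-∉ᵇ-swap false true  true  m = refl
    𝟙-∉ᵇ-swap false true  false m = refl
    𝟙-∉ᵇ-swap false false true  m = refl
    𝟙-∉ᵇ-swap false false false m = refl

    extend-extend : ∀ {Ψ} → PermutationInvariant Ψ → ∀ x y xs → extend (extend Ψ x) y xs ≡ extend (extend Ψ y) x xs
    extend-extend {Ψ} Ψ-inv x y xs =
      trans (cong (λ m → 𝟙 (y ∉ᵇ xs) * (𝟙 (x ∉ᵇ (y ∷ xs)) * m)) (Ψ-inv (swap x y ↭.refl)))
      (trans (cong (λ b → 𝟙 (y ∉ᵇ xs) * (𝟙 (not (b ∨ any (λ z → does (x ≟ z)) xs)) * Ψ (y ∷ x ∷ xs))) (does-sym x y))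
             (𝟙-∉ᵇ-swap (does (y ≟ x)) (any (λ z → does (y ≟ z)) xs) (any (λ z → does (x ≟ z)) xs) (Ψ (y ∷ x ∷ xs))))
      where
      does-sym : ∀ x y → does (x ≟ y) ≡ does (y ≟ x)
      does-sym x y with x ≟ y
      ... | yes refl = sym (dec-true (x ≟ x) refl)
      ... | no  x≢y  = sym (dec-false (y ≟ x) (x≢y ∘ sym))

    ∑tuples-swap : ∀ {Ψ} → PermutationInvariant Ψ → ∀ U g h γ → ∑tuples U Ψ (g ∷ h ∷ γ) ≡ ∑tuples U Ψ (h ∷ g ∷ γ)
    ∑tuples-swap {Ψ} Ψ-inv U g h γ = begin
      ∑ U (λ x → 𝟙 (w x ≡ᵇ g) * ∑ U (λ y → 𝟙 (w y ≡ᵇ h) * ∑tuples U (extend (extend Ψ x) y) γ))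
        ≡⟨ ∑-cong U (λ x → sym (∑-*ˡ U (𝟙 (w x ≡ᵇ g)) _)) ⟩
      ∑ U (λ x → ∑ U (λ y → 𝟙 (w x ≡ᵇ g) * (𝟙 (w y ≡ᵇ h) * ∑tuples U (extend (extend Ψ x) y) γ)))
        ≡⟨ ∑-swap U U _ ⟩
      ∑ U (λ y → ∑ U (λ x → 𝟙 (w x ≡ᵇ g) * (𝟙 (w y ≡ᵇ h) * ∑tuples U (extend (extend Ψ x) y) γ)))
        ≡⟨ ∑-cong U (λ y → ∑-cong U (λ x → trans (*-left-comm (𝟙 (w x ≡ᵇ g)) (𝟙 (w y ≡ᵇ h)) _)
             (cong (λ m → 𝟙 (w y ≡ᵇ h) * (𝟙 (w x ≡ᵇ g) * m)) (∑tuples-cong U γ (extend-extend Ψ-inv x y))))) ⟩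
      ∑ U (λ y → ∑ U (λ x → 𝟙 (w y ≡ᵇ h) * (𝟙 (w x ≡ᵇ g) * ∑tuples U (extend (extend Ψ y) x) γ)))
        ≡⟨ ∑-cong U (λ y → ∑-*ˡ U (𝟙 (w y ≡ᵇ h)) _) ⟩
      ∑ U (λ y → 𝟙 (w y ≡ᵇ h) * ∑ U (λ x → 𝟙 (w x ≡ᵇ g) * ∑tuples U (extend (extend Ψ y) x) γ)) ∎
      where open ≡-Reasoning

  ∑tuples-↭ : ∀ U {Ψ} → PermutationInvariant Ψ → ∀ {γ γ′} → γ ↭ γ′ → ∑tuples U Ψ γ ≡ ∑tuples U Ψ γ′
  ∑tuples-↭ U Ψ-inv ↭.refl          = refl
  ∑tuples-↭ U Ψ-inv (prep g p)      = ∑-cong U (λ x → cong (𝟙 (w x ≡ᵇ g) *_) (∑tuples-↭ U (extend-invariant Ψ-inv x) p))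
  ∑tuples-↭ U Ψ-inv (swap {γ} g h p) = trans (∑tuples-swap Ψ-inv U g h γ)
    (∑-cong U (λ y → cong (𝟙 (w y ≡ᵇ h) *_) (∑-cong U (λ x → cong (𝟙 (w x ≡ᵇ g) *_)
      (∑tuples-↭ U (extend-invariant (extend-invariant Ψ-inv y) x) p)))))
  ∑tuples-↭ U Ψ-inv (↭.trans p q)   = trans (∑tuples-↭ U Ψ-inv p) (∑tuples-↭ U Ψ-inv q)

  module _ (u : A) (U : List A) (u∉U : All (u ≢_) U) where

    private
      u∉ᵇ-∷ : ∀ {x} xs → x ∈ U → u ∉ᵇ (x ∷ xs) ≡ u ∉ᵇ xs
      u∉ᵇ-∷ {x} xs x∈U = cong (λ b → not (b ∨ any (λ y → does (u ≟ y)) xs)) (dec-false (u ≟ x) (All.lookup u∉U x∈U))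

      extend-comm : ∀ Ψ {x} → x ∈ U → ∀ xs → extend (λ T → 𝟙 (u ∉ᵇ T) * Ψ T) x xs ≡ 𝟙 (u ∉ᵇ xs) * extend Ψ x xs
      extend-comm Ψ {x} x∈U xs =
        trans (cong (λ b → 𝟙 (x ∉ᵇ xs) * (𝟙 b * Ψ (x ∷ xs))) (u∉ᵇ-∷ xs x∈U))
              (*-left-comm (𝟙 (x ∉ᵇ xs)) (𝟙 (u ∉ᵇ xs)) (Ψ (x ∷ xs)))

    ∑tuples-avoiding : ∀ γ Ψ → ∑tuples (u ∷ U) (λ T → 𝟙 (u ∉ᵇ T) * Ψ T) γ ≡ ∑tuples U Ψ γ
    ∑tuples-avoiding []      Ψ = +-identityʳ (Ψ [])
    ∑tuples-avoiding (g ∷ γ) Ψ = cong₂ _+_ u-first (∑-cong-∈ U x-first)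
      where
      u-repeated : ∀ xs → extend (λ T → 𝟙 (u ∉ᵇ T) * Ψ T) u xs ≡ 0
      u-repeated xs =
        trans (cong (λ b → 𝟙 (u ∉ᵇ xs) * (𝟙 (not (b ∨ any (λ y → does (u ≟ y)) xs)) * Ψ (u ∷ xs))) (dec-true (u ≟ u) refl))
                            (*-zeroʳ (𝟙 (u ∉ᵇ xs)))
      u-first : 𝟙 (w u ≡ᵇ g) * ∑tuples (u ∷ U) (extend (λ T → 𝟙 (u ∉ᵇ T) * Ψ T) u) γ ≡ 0
      u-first = trans (cong (𝟙 (w u ≡ᵇ g) *_) (trans (∑tuples-cong (u ∷ U) γ u-repeated) (∑tuples-zero (u ∷ U) γ)))
                      (*-zeroʳ (𝟙 (w u ≡ᵇ g)))
      x-first : ∀ x → x ∈ U → 𝟙 (w x ≡ᵇ g) * ∑tuples (u ∷ U) (extend (λ T → 𝟙 (u ∉ᵇ T) * Ψ T) x) γ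
                           ≡ 𝟙 (w x ≡ᵇ g) * ∑tuples U (extend Ψ x) γ
      x-first x x∈U = cong (𝟙 (w x ≡ᵇ g) *_) (trans (∑tuples-cong (u ∷ U) γ (extend-comm Ψ x∈U)) (∑tuples-avoiding γ (extend Ψ x)))

    -- The part of ∑tuples (u ∷ U) Ψ γ coming from the tuples that contain u.
    ∑through : (List A → ℕ) → List ℕ → ℕ
    ∑through Ψ []      = 0
    ∑through Ψ (g ∷ γ) =
      𝟙 (w u ≡ᵇ g) * ∑tuples U (λ T → Ψ (u ∷ T)) γ + ∑ U (λ x → 𝟙 (w x ≡ᵇ g) * ∑through (extend Ψ x) γ)

    ∑tuples-∷ : ∀ γ Ψ → ∑tuples (u ∷ U) Ψ γ ≡ ∑tuples U Ψ γ + ∑through Ψ γ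
    ∑tuples-∷ []      Ψ = sym (+-identityʳ (Ψ []))
    ∑tuples-∷ (g ∷ γ) Ψ = begin
      𝟙 (w u ≡ᵇ g) * ∑tuples (u ∷ U) (extend Ψ u) γ + ∑ U (λ x → 𝟙 (w x ≡ᵇ g) * ∑tuples (u ∷ U) (extend Ψ x) γ)
        ≡⟨ cong₂ _+_ (cong (𝟙 (w u ≡ᵇ g) *_) (∑tuples-avoiding γ (λ T → Ψ (u ∷ T)))) (∑-cong U split) ⟩
      start + ∑ U (λ x → avoid x + through x)
        ≡⟨ cong (start +_) (∑-+ U avoid through) ⟩
      start + (∑ U avoid + ∑ U through)
        ≡⟨ +-left-comm start (∑ U avoid) (∑ U through) ⟩
      ∑ U avoid + (start + ∑ U through) ∎
      where
      open ≡-Reasoning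
      start = 𝟙 (w u ≡ᵇ g) * ∑tuples U (λ T → Ψ (u ∷ T)) γ
      avoid through : A → ℕ
      avoid   x = 𝟙 (w x ≡ᵇ g) * ∑tuples U (extend Ψ x) γ
      through x = 𝟙 (w x ≡ᵇ g) * ∑through (extend Ψ x) γ
      split : ∀ x → 𝟙 (w x ≡ᵇ g) * ∑tuples (u ∷ U) (extend Ψ x) γ ≡ avoid x + through x
      split x = trans (cong (𝟙 (w x ≡ᵇ g) *_) (∑tuples-∷ γ (extend Ψ x))) (*-distribˡ-+ (𝟙 (w x ≡ᵇ g)) _ _)

    -- u can occupy any of the mult (w u) γ slots of weight w u; by invariance, move it to the front.
    ∑through≡ : ∀ {Ψ} → PermutationInvariant Ψ → ∀ γ →
      ∑through Ψ γ ≡ mult (w u) γ * ∑tuples U (λ T → Ψ (u ∷ T)) (remove (w u) γ)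
    ∑through≡ {Ψ} Ψ-inv []      = refl
    ∑through≡ {Ψ} Ψ-inv (g ∷ γ) = trans (cong (𝟙 (w u ≡ᵇ g) * ∑tuples U Ψᵤ γ +_) later-slots) (first-slot g)
      where
      a = w u
      Ψᵤ : List A → ℕ
      Ψᵤ T = Ψ (u ∷ T)
      extend-u : ∀ {x} → x ∈ U → ∀ T → extend Ψ x (u ∷ T) ≡ extend Ψᵤ x T
      extend-u {x} x∈U T =
        cong₂ _*_ (cong (λ b → 𝟙 (not (b ∨ any (λ y → does (x ≟ y)) T))) (dec-false (x ≟ u) (All.lookup u∉U x∈U ∘ sym)))
                  (Ψ-inv (swap x u ↭.refl))
      later-slots : ∑ U (λ x → 𝟙 (w x ≡ᵇ g) * ∑through (extend Ψ x) γ) ≡ mult a γ * ∑tuples U Ψᵤ (g ∷ remove a γ)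
      later-slots = trans (∑-cong-∈ U (λ x x∈U →
          trans (cong (𝟙 (w x ≡ᵇ g) *_) (trans (∑through≡ (extend-invariant Ψ-inv x) γ)
                                                (cong (mult a γ *_) (∑tuples-cong U (remove a γ) (extend-u x∈U)))))
                (*-left-comm (𝟙 (w x ≡ᵇ g)) (mult a γ) _)))
        (∑-*ˡ U (mult a γ) _)
      first-slot : ∀ g → 𝟙 (a ≡ᵇ g) * ∑tuples U Ψᵤ γ + mult a γ * ∑tuples U Ψᵤ (g ∷ remove a γ)
                       ≡ mult a (g ∷ γ) * ∑tuples U Ψᵤ (remove a (g ∷ γ))
      first-slot g with g ≡ᵇ a | ≡ᵇ-reflects-≡ g a
      ... | true  | ofʸ refl rewrite ≡ᵇ-refl a =
        trans (cong (1 * ∑tuples U Ψᵤ γ +_) a-to-front) (sym (*-distribʳ-+ (∑tuples U Ψᵤ γ) 1 (mult a γ)))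
        where
        a-to-front : mult a γ * ∑tuples U Ψᵤ (a ∷ remove a γ) ≡ mult a γ * ∑tuples U Ψᵤ γ
        a-to-front with remove-↭ a γ
        ... | inj₁ none = trans (cong (_* ∑tuples U Ψᵤ (a ∷ remove a γ)) none) (cong (_* ∑tuples U Ψᵤ γ) (sym none))
        ... | inj₂ γ↭   = cong (mult a γ *_) (∑tuples-↭ U (λ p → Ψ-inv (prep u p)) (↭.↭-sym γ↭))
      ... | false | ofⁿ g≢a with a ≡ᵇ g | ≡ᵇ-reflects-≡ a g
      ...   | true  | ofʸ refl = contradiction refl g≢a
      ...   | false | _        = refl

  ∑families-∷ : ∀ u U Ψ γ → Descending γ →
    ∑families (u ∷ U) Ψ γ ≡ ∑families U Ψ γ + 𝟙 (0 <ᵇ mult (w u) γ) * ∑families U (λ T → Ψ (u ∷ T)) (remove (w u) γ)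
  ∑families-∷ u U Ψ γ γ↓ =
    trans (∑-++ (sublists U) (map (u ∷_) (sublists U)) _)
          (cong (∑families U Ψ γ +_) (trans (∑-map (u ∷_) (sublists U) _)
                                            (trans (∑-cong (sublists U) with-u) (∑-*ˡ (sublists U) (𝟙 (0 <ᵇ mult (w u) γ)) _))))
    where
    with-u : ∀ F → 𝟙 (insertDesc (w u) (sortDesc (map w F)) ≟ᴸ γ) * Ψ (u ∷ F)
                 ≡ 𝟙 (0 <ᵇ mult (w u) γ) * (𝟙 (sortDesc (map w F) ≟ᴸ remove (w u) γ) * Ψ (u ∷ F))
    with-u F = trans (cong (λ b → 𝟙 b * Ψ (u ∷ F)) (insertDesc-≟ᴸ (w u) (sortDesc (map w F)) γ γ↓))
                     (trans (cong (_* Ψ (u ∷ F)) (𝟙-∧ (0 <ᵇ mult (w u) γ) _)) (*-assoc (𝟙 (0 <ᵇ mult (w u) γ)) _ (Ψ (u ∷ F))))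

  ∑tuples≡∑families*multFact : ∀ U → Unique U → ∀ {Ψ} → PermutationInvariant Ψ → ∀ γ → Descending γ →
    ∑tuples U Ψ γ ≡ ∑families U Ψ γ * multFact γ
  ∑tuples≡∑families*multFact []      _            {Ψ} _     []      _  =
    sym (trans (*-identityʳ _) (trans (+-identityʳ _) (+-identityʳ (Ψ []))))
  ∑tuples≡∑families*multFact []      _                _     (g ∷ γ) _  = refl
  ∑tuples≡∑families*multFact (u ∷ U) (u∉U AllPairs.∷ U-uniq) {Ψ} Ψ-inv γ       γ↓ = begin
    ∑tuples (u ∷ U) Ψ γ
      ≡⟨ ∑tuples-∷ u U u∉U γ Ψ ⟩
    ∑tuples U Ψ γ + ∑through u U u∉U Ψ γ
      ≡⟨ cong₂ _+_ (∑tuples≡∑families*multFact U U-uniq Ψ-inv γ γ↓) (∑through≡ u U u∉U Ψ-inv γ) ⟩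
    F₁ * multFact γ + m * ∑tuples U Ψᵤ (remove a γ)
      ≡⟨ cong (λ t → F₁ * multFact γ + m * t)
              (∑tuples≡∑families*multFact U U-uniq (λ p → Ψ-inv (prep u p)) (remove a γ) (remove-descending a γ γ↓)) ⟩
    F₁ * multFact γ + m * (F₂ * multFact (remove a γ))
      ≡⟨ cong (F₁ * multFact γ +_) (trans (*-left-comm m F₂ (multFact (remove a γ)))
                                  (trans (cong (F₂ *_) (sym (𝟙-occurs-multFact a γ))) (*-left-comm F₂ i (multFact γ)))) ⟩
    F₁ * multFact γ + i * (F₂ * multFact γ)
      ≡⟨ cong (F₁ * multFact γ +_) (sym (*-assoc i F₂ (multFact γ))) ⟩
    F₁ * multFact γ + i * F₂ * multFact γ
      ≡⟨ sym (*-distribʳ-+ (multFact γ) F₁ (i * F₂)) ⟩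
    (F₁ + i * F₂) * multFact γ
      ≡⟨ cong (_* multFact γ) (sym (∑families-∷ u U Ψ γ γ↓)) ⟩
    ∑families (u ∷ U) Ψ γ * multFact γ ∎
    where
    open ≡-Reasoning
    a = w u
    Ψᵤ : List A → ℕ
    Ψᵤ T = Ψ (u ∷ T)
    m = mult a γ
    i = 𝟙 (0 <ᵇ mult a γ)
    F₁ = ∑families U Ψ γ
    F₂ = ∑families U Ψᵤ (remove a γ)

-- Permutation invariance of L

⋂-↭ : ∀ {n} {xs ys : List (Subset n)} → xs ↭ ys → ⋂ xs ≡ ⋂ ys
⋂-↭ {n} p = foldr-commMonoid (setoid (Subset n)) (∩-isCommutativeMonoid n) (↭⇒↭ₛ p)

rho-↭ : ∀ {n} d {xs ys : List (Subset n)} → xs ↭ ys → rho d xs ≡ rho d ys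
rho-↭ d {xs} {ys} p = begin
  rho d xs                           ≡⟨ List.foldr-map ℤ._+_ (codim d) +0 xs ⟨
  foldr ℤ._+_ +0 (map (codim d) xs)  ≡⟨ foldr-commMonoid (setoid ℤ.ℤ) ℤ.+-0-isCommutativeMonoid (↭⇒↭ₛ (↭.map⁺ (codim d) p)) ⟩
  foldr ℤ._+_ +0 (map (codim d) ys)  ≡⟨ List.foldr-map ℤ._+_ (codim d) +0 ys ⟩
  rho d ys                           ∎
  where open ≡-Reasoning

and-++ : ∀ bs cs → and (bs ++ cs) ≡ and bs ∧ and cs
and-++ []       cs = refl
and-++ (b ∷ bs) cs = trans (cong (b ∧_) (and-++ bs cs)) (sym (∧-assoc b (and bs) (and cs)))

all-sublists-∷ : ∀ (q : List A → Bool) x xs →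
  all q (sublists (x ∷ xs)) ≡ all q (sublists xs) ∧ all (λ F → q (x ∷ F)) (sublists xs)
all-sublists-∷ q x xs =
  trans (cong and (List.map-++ q (sublists xs) (map (x ∷_) (sublists xs))))
        (trans (and-++ (map q (sublists xs)) _) (cong (all q (sublists xs) ∧_) (cong and (sym (List.map-∘ (sublists xs))))))

all-sublists-↭ : ∀ (q : List A → Bool) → (∀ {F G} → F ↭ G → q F ≡ q G) →
  ∀ {xs ys} → xs ↭ ys → all q (sublists xs) ≡ all q (sublists ys)
all-sublists-↭ q q-inv ↭.refl = refl
all-sublists-↭ q q-inv (prep {xs} {ys} x p) =
  trans (all-sublists-∷ q x xs)
  (trans (cong₂ _∧_ (all-sublists-↭ q q-inv p) (all-sublists-↭ (λ F → q (x ∷ F)) (q-inv ∘ prep x) p))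
         (sym (all-sublists-∷ q x ys)))
all-sublists-↭ q q-inv (swap {xs} {ys} x y p) = begin
  all q (sublists (x ∷ y ∷ xs))
    ≡⟨ expand x y xs ⟩
  (every q xs ∧ every (q ∘ (y ∷_)) xs) ∧ (every (q ∘ (x ∷_)) xs ∧ every (q ∘ (x ∷_) ∘ (y ∷_)) xs)
    ≡⟨ cong₂ _∧_ (cong₂ _∧_ (all-sublists-↭ q q-inv p) (all-sublists-↭ (q ∘ (y ∷_)) (q-inv ∘ prep y) p))
                 (cong₂ _∧_ (all-sublists-↭ (q ∘ (x ∷_)) (q-inv ∘ prep x) p)
                            (trans (all-sublists-↭ (q ∘ (x ∷_) ∘ (y ∷_)) (q-inv ∘ prep x ∘ prep y) p)
                                   (cong and (List.map-cong (λ F → q-inv (swap x y ↭.refl)) (sublists ys))))) ⟩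
  (every q ys ∧ every (q ∘ (y ∷_)) ys) ∧ (every (q ∘ (x ∷_)) ys ∧ every (q ∘ (y ∷_) ∘ (x ∷_)) ys)
    ≡⟨ ∧-interchange (every q ys) _ _ _ ⟩
  (every q ys ∧ every (q ∘ (x ∷_)) ys) ∧ (every (q ∘ (y ∷_)) ys ∧ every (q ∘ (y ∷_) ∘ (x ∷_)) ys)
    ≡⟨ expand y x ys ⟨
  all q (sublists (y ∷ x ∷ ys)) ∎
  where
  open ≡-Reasoning
  every : (List _ → Bool) → List _ → Bool
  every f zs = all f (sublists zs)
  expand : ∀ x y zs → all q (sublists (x ∷ y ∷ zs))
    ≡ (every q zs ∧ every (q ∘ (y ∷_)) zs) ∧ (every (q ∘ (x ∷_)) zs ∧ every (q ∘ (x ∷_) ∘ (y ∷_)) zs)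
  expand x y zs = trans (all-sublists-∷ q x (y ∷ zs))
                        (cong₂ _∧_ (all-sublists-∷ q y zs) (all-sublists-∷ (q ∘ (x ∷_)) y zs))
all-sublists-↭ q q-inv (↭.trans p p′) = trans (all-sublists-↭ q q-inv p) (all-sublists-↭ q q-inv p′)

isL-↭ : ∀ {n} d {xs ys : List (Subset n)} → xs ↭ ys → isL d xs ≡ isL d ys
isL-↭ d p = cong₂ _∧_ (all-↭ (λ X → ∣ X ∣ ≤ᵇ d) p) (all-sublists-↭ (admissible d) admissible-↭ p)
  where
  admissible-↭ : ∀ {F G} → F ↭ G → admissible d F ≡ admissible d G
  admissible-↭ q = cong₂ (λ k z → (k ≤ᵇ 1) Bool.∨ ⌊ +0 ℤ.<? z ⌋) (↭.↭-length q)
                         (cong₂ ℤ._-_ (cong (codim d) (⋂-↭ q)) (rho-↭ d q))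

unique-allSubsets : ∀ n → Unique (allSubsets n)
unique-allSubsets zero    = All.[] AllPairs.∷ AllPairs.[]
unique-allSubsets (suc n) =
  Unique.++⁺ (Unique.map⁺ Vec.∷-injectiveʳ (unique-allSubsets n)) (Unique.map⁺ Vec.∷-injectiveʳ (unique-allSubsets n)) first-bit
  where
  first-bit : Disjoint (map (false ∷_) (allSubsets n)) (map (true ∷_) (allSubsets n))
  first-bit (v∈₀ , v∈₁) with ∈-map⁻ (false ∷_) v∈₀ | ∈-map⁻ (true ∷_) v∈₁
  ... | _ , _ , refl | _ , _ , ()

-- Counting L̃ by families

module _ (n d : ℕ) where

  open OrderedCount (Vec.≡-dec Bool._≟_) (codimℕ {n} d)

  𝟙isL : List (Subset n) → ℕ
  𝟙isL F = 𝟙 (isL d F)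

  ∑allTuples≡∑tuples : ∀ γ (Ψ : List (Subset n) → ℕ) →
    ∑ (allTuples n (length γ)) (λ T → 𝟙 (pairwiseDistinct (toList T) ∧ (map (codimℕ d) (toList T) ≟ᴸ γ)) * Ψ (toList T))
      ≡ ∑tuples (allSubsets n) Ψ γ
  ∑allTuples≡∑tuples []      Ψ = trans (+-identityʳ _) (+-identityʳ (Ψ []))
  ∑allTuples≡∑tuples (g ∷ γ) Ψ =
    trans (∑-concatMap (λ S → map (S ∷_) Tups) (allSubsets n) _)
          (∑-cong (allSubsets n) (λ S → trans (∑-map (S ∷_) Tups _)
            (trans (∑-cong Tups (first-entry S))
                   (trans (∑-*ˡ Tups (𝟙 (codimℕ d S ≡ᵇ g)) _)
                          (cong (𝟙 (codimℕ d S ≡ᵇ g) *_) (∑allTuples≡∑tuples γ (extend Ψ S)))))))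
    where
    Tups = allTuples n (length γ)
    𝟙-∧-∧-* : ∀ a b c e x → 𝟙 ((a ∧ b) ∧ (c ∧ e)) * x ≡ 𝟙 c * (𝟙 (b ∧ e) * (𝟙 a * x))
    𝟙-∧-∧-* a b c e x rewrite 𝟙-∧ (a ∧ b) (c ∧ e) | 𝟙-∧ a b | 𝟙-∧ c e | 𝟙-∧ b e =
      rearrange (𝟙 a) (𝟙 b) (𝟙 c) (𝟙 e) x
      where
      rearrange : ∀ a b c e x → a * b * (c * e) * x ≡ c * (b * e * (a * x))
      rearrange = solve-∀
    first-entry : ∀ S T →
      𝟙 (((S ∉ᵇ toList T) ∧ pairwiseDistinct (toList T)) ∧ ((codimℕ d S ≡ᵇ g) ∧ (map (codimℕ d) (toList T) ≟ᴸ γ)))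
        * Ψ (S ∷ toList T)
      ≡ 𝟙 (codimℕ d S ≡ᵇ g) * (𝟙 (pairwiseDistinct (toList T) ∧ (map (codimℕ d) (toList T) ≟ᴸ γ)) * extend Ψ S (toList T))
    first-entry S T = 𝟙-∧-∧-* (S ∉ᵇ toList T) (pairwiseDistinct (toList T)) (codimℕ d S ≡ᵇ g)
                              (map (codimℕ d) (toList T) ≟ᴸ γ) (Ψ (S ∷ toList T))

  length-Ltilde≡∑tuples : ∀ γ → length (Ltilde n d γ) ≡ ∑tuples (allSubsets n) 𝟙isL γ
  length-Ltilde≡∑tuples γ =
    trans (length≡∑ (Ltilde n d γ))
    (trans (∑-filter (λ T → Bool.T? (inLtilde d γ T)) Tups _)
    (trans (∑-cong Tups (λ T → split (pairwiseDistinct (toList T)) (isL d (toList T)) (map (codimℕ d) (toList T) ≟ᴸ γ)))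
           (∑allTuples≡∑tuples γ 𝟙isL)))
    where
    Tups = allTuples n (length γ)
    split : ∀ a b c → 𝟙 (a ∧ b ∧ c) * 1 ≡ 𝟙 (a ∧ c) * 𝟙 b
    split a b c rewrite 𝟙-∧ a (b ∧ c) | 𝟙-∧ b c | 𝟙-∧ a c = rearrange (𝟙 a) (𝟙 b) (𝟙 c)
      where
      rearrange : ∀ a b c → a * (b * c) * 1 ≡ a * c * b
      rearrange = solve-∀

  lambda≡∑families : ∀ γ → lambda n d γ ≡ ∑families (allSubsets n) 𝟙isL γ
  lambda≡∑families γ =
    trans (length≡∑ (filter (λ F → Bool.T? (typeOf d F ≟ᴸ γ)) (Lfam n d)))
    (trans (∑-filter (λ F → Bool.T? (typeOf d F ≟ᴸ γ)) (Lfam n d) _)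
    (trans (∑-filter (λ F → Bool.T? (isL d F)) (sublists (allSubsets n)) _)
           (∑-cong (sublists (allSubsets n)) (λ F → rearrange (𝟙isL F) (𝟙 (typeOf d F ≟ᴸ γ))))))
    where
    rearrange : ∀ a b → a * (b * 1) ≡ b * a
    rearrange = solve-∀

type-descending : ∀ {n} d (F : List (Subset n)) → Descending (typeOf d F)
type-descending d F = sortDesc-descending (map (codimℕ d) F)

type-positive : ∀ {n} d (F : List (Subset n)) → T (isL d F) → All (1 ≤_) (typeOf d F)
type-positive d F F∈L =
  sortDesc-All (map (codimℕ d) F) (All.map⁺ (All.map (λ {X} ∣X∣≤d → m<n⇒0<n∸m (s≤s (≤ᵇ⇒≤ ∣ X ∣ d ∣X∣≤d)))
                                              (All.all⁺ (λ X → ∣ X ∣ ≤ᵇ d) F (proj₁ (Equivalence.to Bool.T-∧ F∈L)))))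

proposition17 : (d k n : ℕ) → 1 ≤ d → n ≡ d + k + 1 →
    (γ : List ℕ) → γ ≢ [] → Any (λ T → typeOf d T ≡ γ) (Lfam n d) →
    lambda n d γ * multFactProd γ ≡ sum (map (multinomial n) (Nset n d γ))
proposition17 d k n _ _ γ _ γ-realised with find γ-realised
... | F , F∈L , refl = begin
  lambda n d γ * multFactProd γ
    ≡⟨ cong₂ _*_ (lambda≡∑families n d γ) (multFactProd≡multFact γ (type-positive d F F∈L-holds)) ⟩
  ∑families (allSubsets n) (𝟙isL n d) γ * multFact γ
    ≡⟨ ∑tuples≡∑families*multFact (allSubsets n) (unique-allSubsets n) (cong 𝟙 ∘ isL-↭ d) γ (type-descending d F) ⟨
  ∑tuples (allSubsets n) (𝟙isL n d) γ
    ≡⟨ length-Ltilde≡∑tuples n d γ ⟨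
  length (Ltilde n d γ)
    ≡⟨ length-Ltilde≡∑-multinomial n d γ ⟩
  sum (map (multinomial n) (Nset n d γ)) ∎
  where
  open ≡-Reasoning
  open OrderedCount (Vec.≡-dec Bool._≟_) (codimℕ {n} d)
  F∈L-holds : T (isL d F)
  F∈L-holds = proj₂ (∈-filter⁻ (λ F → Bool.T? (isL d F)) {xs = allFamilies n} F∈L)
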